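{- The sorting operators $\mathbf{S}$ (stack sorting), $\mathbf{B}$ (bubble sort) and $\mathbf{Q}$ (queue and bypass) are all $\mathsf{TOTO}$-definable. Consequently, for any finite composition $F$ of these operators, the set $F^{ -1}(\mathcal{I})=\{\sigma : F(\sigma)\text{ is increasing}\}$ is definable in $\mathsf{TOTO}$.
   Context: A permutation $\sigma$ of size $n$ is identified with the finite structure whose domain is $A^\sigma=\{(i,\sigma(i))\}$, with position order $<_P$ (first coordinates) and value order $<_V$ (second coordinates); $\mathsf{TOTO}$ is first-order logic (with equality) over the signature $\{<_P,<_V\}$. A set of permutations is definable in $\mathsf{TOTO}$ if it is the set of permutations satisfying some $\mathsf{TOTO}$ sentence. $\mathcal{I}=\{12\cdots n:n\ge1\}$. A sorting operator $S$ maps each permutation to a rearrangement of its values; identifying elements with their values, $a\prec_{S(P)}b$ means the value of $a$ precedes that of $b$ in $S(\sigma)$. $S$ is $\mathsf{TOTO}$-definable if there is a $\mathsf{TOTO}$ formula $\phi(x,y)$ with $(\sigma,a,b)\models\phi$ iff $a\prec_{S(P)}b$, for all $\sigma$ and elements $a,b$. Operators (input processed left to right in one-line notation): $\mathbf{S}$ uses a stack kept increasing from top to bottom: before pushing a new entry, pop to the output all top entries smaller than it; at the end flush the stack. $\mathbf{B}$ uses a one-element buffer: the first entry goes into the buffer; a new entry is output directly if the buffer holds a larger value, otherwise the buffer's element is output and the new entry is placed in the buffer; at the end the buffer is output. $\mathbf{Q}$ uses a queue whose elements are increasing: a new entry is appended to the queue if it is greater than the last element of the queue (or the queue is empty); it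 is output directly if it is smaller than the first element of the queue; otherwise all elements of the queue smaller than it are output (from the front) and then it is appended to the queue if the queue is now empty, or output if greater elements remain; at the end the queue is emptied to the output. -}

module Defs where

open import Data.Nat using (ℕ; zero; suc; _<ᵇ_; _≡ᵇ_; _≤_)
open import Data.Fin using (Fin; toℕ)
open import Data.Bool using (Bool; true; false; not; _∧_; _∨_; if_then_else_)
open import Data.List using (List; []; _∷_; _++_; [_]; map; allFin; upTo)
open import Data.Bool.ListAction using (all; any)
open import Data.Vec using (Vec; lookup) renaming (_∷_ to _∷v_; [] to []v)
open import Data.Product using (Σ; ∃; _×_; _,_)
open import Function using (_∘_; _⇔_)
open import Function.Definitions using (Injective)
open import Relation.Binary.PropositionalEquality using (_≡_)

-- The element (i , σ(i)) of A^σ is represented by its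
-- position i : Fin n.  Values are 0-based (σ i ∈ {0,…,n-1}).

record Perm (n : ℕ) : Set where
  field
    fun : Fin n → Fin n
    inj : Injective _≡_ _≡_ fun
open Perm public

val : ∀ {n} → Perm n → Fin n → ℕ
val σ a = toℕ (fun σ a)

oneLine : ∀ {n} → Perm n → List ℕ
oneLine {n} σ = map (val σ) (allFin n)

-- TOTO: first-order logic with equality over signature {<_P , <_V}.
-- Formulas with k free variables (de Bruijn: variable zero is the most
-- recently bound one).

data Formula (k : ℕ) : Set where
  _<P_ : Fin k → Fin k → Formula k
  _<V_ : Fin k → Fin k → Formula k
  _≐_  : Fin k → Fin k → Formula k
  ⊥f   : Formula k
  ¬f_  : Formula k → Formula k
  _∧f_ : Formula k → Formula k → Formula k
  _∨f_ : Formula k → Formula k → Formula k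
  ∀f   : Formula (suc k) → Formula k
  ∃f   : Formula (suc k) → Formula k

eval : ∀ {n k} → Perm n → Formula k → Vec (Fin n) k → Bool
eval σ (x <P y) ρ = toℕ (lookup ρ x) <ᵇ toℕ (lookup ρ y)
eval σ (x <V y) ρ = val σ (lookup ρ x) <ᵇ val σ (lookup ρ y)
eval σ (x ≐ y)  ρ = toℕ (lookup ρ x) ≡ᵇ toℕ (lookup ρ y)
eval σ ⊥f       ρ = false
eval σ (¬f φ)   ρ = not (eval σ φ ρ)
eval σ (φ ∧f ψ) ρ = eval σ φ ρ ∧ eval σ ψ ρ
eval σ (φ ∨f ψ) ρ = eval σ φ ρ ∨ eval σ ψ ρ
eval {n} σ (∀f φ) ρ = all (λ a → eval σ φ (a ∷v ρ)) (allFin n)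
eval {n} σ (∃f φ) ρ = any (λ a → eval σ φ (a ∷v ρ)) (allFin n)

_⊨_[_,_] : ∀ {n} → Perm n → Formula 2 → Fin n → Fin n → Set
σ ⊨ φ [ a , b ] = eval σ φ (a ∷v b ∷v []v) ≡ true

SetOfPerms : Set₁
SetOfPerms = (n : ℕ) → Perm n → Set

Definable : SetOfPerms → Set
Definable P = Σ (Formula 0) λ φ →
  (n : ℕ) (σ : Perm n) → (eval σ φ []v ≡ true) ⇔ P n σ

Precedes : List ℕ → ℕ → ℕ → Set
Precedes l x y = ∃ λ (us : List ℕ) → ∃ λ (vs : List ℕ) → ∃ λ (ws : List ℕ) →
  l ≡ us ++ (x ∷ vs ++ (y ∷ ws))

OpDefinable : (List ℕ → List ℕ) → Set
OpDefinable S = Σ (Formula 2) λ φ →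
  (n : ℕ) (σ : Perm n) (a b : Fin n) →
    (σ ⊨ φ [ a , b ]) ⇔ Precedes (S (oneLine σ)) (val σ a) (val σ b)

-- Stack sorting S: stack (head = top) kept increasing from top to bottom.
-- Pop all top entries smaller than x; returns (output, new stack).
stackPush : ℕ → List ℕ → List ℕ × List ℕ
stackPush x [] = [] , x ∷ []
stackPush x (t ∷ st) with t <ᵇ x
... | true  with stackPush x st
...   | o , s = t ∷ o , s
stackPush x (t ∷ st) | false = [] , x ∷ t ∷ st

stackRun : List ℕ → List ℕ → List ℕ   -- current stack, remaining input
stackRun st [] = st
stackRun st (x ∷ xs) with stackPush x st
... | o , s = o ++ stackRun s xs

stackSort : List ℕ → List ℕ
stackSort = stackRun []

-- Bubble sort B (one pass with a one-element buffer).
bubbleRun : ℕ → List ℕ → List ℕ       -- buffer content, remaining input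
bubbleRun b [] = b ∷ []
bubbleRun b (x ∷ xs) =
  if x <ᵇ b then x ∷ bubbleRun b xs else b ∷ bubbleRun x xs

bubbleSort : List ℕ → List ℕ
bubbleSort [] = []
bubbleSort (x ∷ xs) = bubbleRun x xs

-- Queue and bypass Q.  The queue is a list, head = front.
-- x can be appended: queue empty or x greater than its last element
appendable : ℕ → List ℕ → Bool
appendable x [] = true
appendable x (y ∷ []) = y <ᵇ x
appendable x (y ∷ z ∷ zs) = appendable x (z ∷ zs)

belowFront : ℕ → List ℕ → Bool
belowFront x [] = false
belowFront x (y ∷ _) = x <ᵇ y

splitLt : ℕ → List ℕ → List ℕ × List ℕ
splitLt x [] = [] , []
splitLt x (y ∷ ys) with y <ᵇ x
... | true with splitLt x ys
...   | s , r = y ∷ s , r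
splitLt x (y ∷ ys) | false = [] , y ∷ ys

queueRun : List ℕ → List ℕ → List ℕ   -- current queue, remaining input
queueRun q [] = q
queueRun q (x ∷ xs) with appendable x q | belowFront x q | splitLt x q
... | true  | _     | _ = queueRun (q ++ [ x ]) xs
... | false | true  | _ = x ∷ queueRun q xs
... | false | false | s , [] = s ++ queueRun [ x ] xs
... | false | false | s , (r ∷ rs) = s ++ (x ∷ queueRun (r ∷ rs) xs)

queueSort : List ℕ → List ℕ
queueSort = queueRun []

data Op : Set where
  S B Q : Op

apply : Op → List ℕ → List ℕ
apply S = stackSort
apply B = bubbleSort
apply Q = queueSort

-- [O₁ , … , O_k] denotes O₁ ∘ ⋯ ∘ O_k
compose : List Op → List ℕ → List ℕ
compose [] l = l
compose (o ∷ os) l = apply o (compose os l)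

-- F⁻¹(I): permutations σ (of size n ≥ 1) with F(σ) = 12⋯n
-- (0-based values: the increasing list 0 1 … n-1)
preimageI : List Op → SetOfPerms
preimageI F n σ = (1 ≤ n) × (compose F (oneLine σ) ≡ upTo n)

-- Each operator outputs the entries of σ sorted by the pair (output time, value):
-- an entry u leaves while some later entry c is read (its time is the position of c)
-- or in the final flush, and the entries leaving together do so in increasing order.
-- For stack sorting c is the first later entry larger than u. Bubble sort and queue
-- and bypass output u at once if it is not a left-to-right maximum; otherwise c is the
-- first later larger entry, respectively the first later entry above u that is not a
-- left-to-right maximum. These descriptions are first-order in the two orders, hence
-- so is "u is output before v". Substituting such a formula for the position order
-- handles compositions, and F(σ) is increasing iff the composed formula coincides
-- with the value order.

module Submission where

open import Defs
open import Data.Bool using (Bool; true; false; not; _∧_; _∨_; if_then_else_)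
open import Data.Bool.Properties using (T-≡)
open import Data.Bool.ListAction using (all; any; and; or)
open import Data.Empty using (⊥-elim)
open import Data.Fin using (Fin; toℕ; zero; suc; fromℕ<)
open import Data.Fin.Properties using (toℕ-injective; toℕ<n; toℕ-fromℕ<)
import Data.Fin.Properties as Finₚ
import Data.List as List
open import Data.List using (List; []; _∷_; _++_; [_]; map; allFin; tabulate; length; upTo)
open import Data.List.Properties using (tabulate-cong; map-upTo; ++-assoc; ++-identityʳ; map-tabulate; tabulate-lookup; length-tabulate; map-cong)
open import Data.List.Membership.Propositional using (_∈_; _∉_)
open import Data.List.Membership.Propositional.Properties using (∈-allFin; ∈-∃++; ∈-tabulate⁺; ∈-tabulate⁻; ∈-++⁺ˡ; ∈-++⁺ʳ; ∈-++⁻)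
open import Data.List.Relation.Unary.Any as Any using (here; there)
import Data.List.Relation.Unary.Any.Properties as AnyP
open import Data.List.Relation.Unary.All as All using (All; []; _∷_)
import Data.List.Relation.Unary.All.Properties as AllP
open import Data.List.Relation.Unary.AllPairs as AllPairs using (AllPairs; []; _∷_)
import Data.List.Relation.Unary.AllPairs.Properties as APP
open import Data.List.Relation.Binary.Permutation.Propositional using (_↭_; swap; ↭-refl; ↭-reflexive; ↭-trans; ↭-sym; prep)
open import Data.List.Relation.Binary.Permutation.Propositional.Properties using (++⁺ˡ; shift; ∈-resp-↭; ↭-length)
open import Data.Nat using (ℕ; zero; suc; _≟_; z<s; s<s; s<s⁻¹; _⊔_; _<ᵇ_; _≡ᵇ_; _≤_; _<_; z≤n; s≤s; _+_; _<?_; _∸_)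
open import Data.Nat.Properties using (n<1+n; m<m+n; m+1+n≢m; ≤-reflexive; m≤n⇒m⊔n≡n; m≥n⇒m⊔n≡m; ⊔-sel; ⊔-identityˡ; m≤m⊔n; m≤n⊔m; ≤∧≢⇒<; <ᵇ⇒<; <⇒<ᵇ; ≡ᵇ⇒≡; ≡⇒≡ᵇ; ≤-refl; ≤-trans; <-trans; <-irrefl; <-asym; <-cmp; ≮⇒≥; ≤-antisym; <⇒≤; n≤1+n; <-≤-trans; ≤-<-trans; +-suc; +-identityʳ; +-comm; +-cancelʳ-≤; +-monoˡ-≤; m+[n∸m]≡n; m≤m+n)
open import Data.Product using (Σ; ∃; _×_; _,_; proj₁; proj₂)
open import Data.Sum using (_⊎_; inj₁; inj₂; [_,_]′)
open import Data.Vec using (Vec; lookup) renaming (_∷_ to _∷v_; [] to []v; map to vmap)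
open import Data.Vec.Properties using (lookup-map)
open import Function using (_∘_; _⇔_; mk⇔)
open import Function.Bundles using (Equivalence)
open import Relation.Binary.Definitions using (tri<; tri≈; tri>)
open import Relation.Binary.PropositionalEquality using (_≡_; _≢_; refl; sym; trans; cong; cong₂; subst; subst₂)
open import Relation.Nullary using (¬_; yes; no; does)
open import Relation.Nullary.Decidable using (dec-true; dec-false)
open import Data.List.Membership.DecPropositional _≟_ using (_∈?_)

bool-ext : ∀ {b c : Bool} → (b ≡ true → c ≡ true) → (c ≡ true → b ≡ true) → b ≡ c
bool-ext {true}  {true}  f g = refl
bool-ext {true}  {false} f g = sym (f refl)
bool-ext {false} {true}  f g = g refl
bool-ext {false} {false} f g = refl

¬true⇒false : ∀ b → b ≢ true → b ≡ false
¬true⇒false true  f = ⊥-elim (f refl)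
¬true⇒false false f = refl

false⇒¬true : ∀ {b} → b ≡ false → b ≢ true
false⇒¬true refl ()

bool-case : ∀ {C : Set} (b : Bool) → (b ≡ true → C) → (b ≡ false → C) → C
bool-case true  f g = f refl
bool-case false f g = g refl

∧-true : ∀ {a b} → a ≡ true → b ≡ true → (a ∧ b) ≡ true
∧-true refl refl = refl

∧-true⁻ : ∀ {a b} → (a ∧ b) ≡ true → a ≡ true × b ≡ true
∧-true⁻ {true} e = refl , e

∨-trueˡ : ∀ {a b} → a ≡ true → (a ∨ b) ≡ true
∨-trueˡ refl = refl

∨-trueʳ : ∀ {a b} → b ≡ true → (a ∨ b) ≡ true
∨-trueʳ {true}  e = refl
∨-trueʳ {false} e = e

∨-true⁻ : ∀ {a b} → (a ∨ b) ≡ true → a ≡ true ⊎ b ≡ true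
∨-true⁻ {true}  e = inj₁ refl
∨-true⁻ {false} e = inj₂ e

not-true : ∀ {a} → a ≢ true → not a ≡ true
not-true {true}  f = ⊥-elim (f refl)
not-true {false} f = refl

not-true⁻ : ∀ {a} → not a ≡ true → a ≢ true
not-true⁻ {true} ()

<ᵇ-true⇒< : ∀ {m n} → (m <ᵇ n) ≡ true → m < n
<ᵇ-true⇒< {m} {n} e = <ᵇ⇒< m n (Equivalence.from T-≡ e)

<⇒<ᵇ-true : ∀ {m n} → m < n → (m <ᵇ n) ≡ true
<⇒<ᵇ-true p = Equivalence.to T-≡ (<⇒<ᵇ p)

≮⇒<ᵇ-false : ∀ {m n} → ¬ m < n → (m <ᵇ n) ≡ false
≮⇒<ᵇ-false {m} {n} p = ¬true⇒false _ (p ∘ <ᵇ-true⇒<)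

≡ᵇ-true⇒≡ : ∀ {m n} → (m ≡ᵇ n) ≡ true → m ≡ n
≡ᵇ-true⇒≡ {m} {n} e = ≡ᵇ⇒≡ m n (Equivalence.from T-≡ e)

≡⇒≡ᵇ-true : ∀ {m n} → m ≡ n → (m ≡ᵇ n) ≡ true
≡⇒≡ᵇ-true {m} {n} p = Equivalence.to T-≡ (≡⇒≡ᵇ m n p)

≡ᵇ-refl : ∀ n → (n ≡ᵇ n) ≡ true
≡ᵇ-refl n = ≡⇒≡ᵇ-true {n} refl

≢⇒≡ᵇ-false : ∀ {m n} → m ≢ n → (m ≡ᵇ n) ≡ false
≢⇒≡ᵇ-false p = ¬true⇒false _ (p ∘ ≡ᵇ-true⇒≡)

all-allFin⁻ : ∀ {n} (p : Fin n → Bool) → all p (allFin n) ≡ true → ∀ i → p i ≡ true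
all-allFin⁻ p e i = Equivalence.to T-≡ (All.lookup (AllP.all⁺ p (allFin _) (Equivalence.from T-≡ e)) (∈-allFin i))

all-allFin⁺ : ∀ {n} (p : Fin n → Bool) → (∀ i → p i ≡ true) → all p (allFin n) ≡ true
all-allFin⁺ p f = Equivalence.to T-≡ (AllP.all⁻ p (All.universal (Equivalence.from T-≡ ∘ f) (allFin _)))

any-allFin⁻ : ∀ {n} (p : Fin n → Bool) → any p (allFin n) ≡ true → ∃ λ i → p i ≡ true
any-allFin⁻ p e with Any.satisfied (AnyP.any⁻ p (allFin _) (Equivalence.from T-≡ e))
... | i , t = i , Equivalence.to T-≡ t

any-allFin⁺ : ∀ {n} (p : Fin n → Bool) i → p i ≡ true → any p (allFin n) ≡ true
any-allFin⁺ p i e = Equivalence.to T-≡ (AnyP.any⁺ p (Any.map (λ { refl → Equivalence.from T-≡ e }) (∈-allFin i)))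

all-cong : ∀ {A : Set} {p q : A → Bool} (l : List A) → (∀ x → p x ≡ q x) → all p l ≡ all q l
all-cong l f = cong and (map-cong f l)

any-cong : ∀ {A : Set} {p q : A → Bool} (l : List A) → (∀ x → p x ≡ q x) → any p l ≡ any q l
any-cong l f = cong or (map-cong f l)

Iff : Set → Set → Set
Iff X Y = (X → Y) × (Y → X)

iff-refl : ∀ {X : Set} → Iff X X
iff-refl = (λ x → x) , (λ x → x)

iff-sym : ∀ {X Y : Set} → Iff X Y → Iff Y X
iff-sym (f , g) = g , f

iff-trans : ∀ {X Y Z : Set} → Iff X Y → Iff Y Z → Iff X Z
iff-trans (f , g) (h , i) = (h ∘ f) , (g ∘ i)

×-iff : ∀ {X X′ Y Y′ : Set} → Iff X X′ → Iff Y Y′ → Iff (X × Y) (X′ × Y′)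
×-iff (f , g) (h , i) = (λ (x , y) → f x , h y) , (λ (x , y) → g x , i y)

⊎-iff : ∀ {X X′ Y Y′ : Set} → Iff X X′ → Iff Y Y′ → Iff (X ⊎ Y) (X′ ⊎ Y′)
⊎-iff (f , g) (h , i) = (λ { (inj₁ x) → inj₁ (f x) ; (inj₂ y) → inj₂ (h y) }) ,
                        (λ { (inj₁ x) → inj₁ (g x) ; (inj₂ y) → inj₂ (i y) })

¬-iff : ∀ {X Y : Set} → Iff X Y → Iff (¬ X) (¬ Y)
¬-iff (f , g) = (λ ¬x y → ¬x (g y)) , (λ ¬y x → ¬y (f x))

∧-iff : ∀ {a b X Y} → Iff (a ≡ true) X → Iff (b ≡ true) Y → Iff ((a ∧ b) ≡ true) (X × Y)
∧-iff {a} ha hb = iff-trans (∧-true⁻ {a} , λ (p , q) → ∧-true p q) (×-iff ha hb)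

∨-iff : ∀ {a b X Y} → Iff (a ≡ true) X → Iff (b ≡ true) Y → Iff ((a ∨ b) ≡ true) (X ⊎ Y)
∨-iff {a} ha hb =
  iff-trans (∨-true⁻ {a} , λ { (inj₁ p) → ∨-trueˡ p ; (inj₂ q) → ∨-trueʳ {a} q }) (⊎-iff ha hb)

not-iff : ∀ {a X} → Iff (a ≡ true) X → Iff (not a ≡ true) (¬ X)
not-iff h = iff-trans (not-true⁻ , not-true) (¬-iff h)

iff-≡true : ∀ {a b X} → a ≡ b → Iff (b ≡ true) X → Iff (a ≡ true) X
iff-≡true refl h = h

<ᵇ-iff : ∀ {m n} → Iff ((m <ᵇ n) ≡ true) (m < n)
<ᵇ-iff = <ᵇ-true⇒< , <⇒<ᵇ-true

≡ᵇ-iff : ∀ {m n} → Iff ((m ≡ᵇ n) ≡ true) (m ≡ n)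
≡ᵇ-iff = ≡ᵇ-true⇒≡ , ≡⇒≡ᵇ-true

all-iff : ∀ {n} {p : Fin n → Bool} {X : Fin n → Set} → (∀ i → Iff (p i ≡ true) (X i)) →
  Iff (all p (allFin n) ≡ true) (∀ i → X i)
all-iff h = (λ e i → proj₁ (h i) (all-allFin⁻ _ e i)) , (λ f → all-allFin⁺ _ (λ i → proj₂ (h i) (f i)))

any-iff : ∀ {n} {p : Fin n → Bool} {X : Fin n → Set} → (∀ i → Iff (p i ≡ true) (X i)) →
  Iff (any p (allFin n) ≡ true) (∃ X)
any-iff h = (λ e → let (i , q) = any-allFin⁻ _ e in i , proj₁ (h i) q) ,
            (λ (i , x) → any-allFin⁺ _ i (proj₂ (h i) x))

-- Formulas are evaluated over any pair of Boolean relations on Fin n; this lets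
-- the position order be reinterpreted by a formula (composition of operators).
evalWith : ∀ {n k} → (Fin n → Fin n → Bool) → (Fin n → Fin n → Bool) → Formula k → Vec (Fin n) k → Bool
evalWith P V (x <P y) ρ = P (lookup ρ x) (lookup ρ y)
evalWith P V (x <V y) ρ = V (lookup ρ x) (lookup ρ y)
evalWith P V (x ≐ y)  ρ = toℕ (lookup ρ x) ≡ᵇ toℕ (lookup ρ y)
evalWith P V ⊥f       ρ = false
evalWith P V (¬f φ)   ρ = not (evalWith P V φ ρ)
evalWith P V (φ ∧f ψ) ρ = evalWith P V φ ρ ∧ evalWith P V ψ ρ
evalWith P V (φ ∨f ψ) ρ = evalWith P V φ ρ ∨ evalWith P V ψ ρ
evalWith {n} P V (∀f φ) ρ = all (λ a → evalWith P V φ (a ∷v ρ)) (allFin n)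
evalWith {n} P V (∃f φ) ρ = any (λ a → evalWith P V φ (a ∷v ρ)) (allFin n)

posLt : ∀ {n} → Fin n → Fin n → Bool
posLt a b = toℕ a <ᵇ toℕ b

valueLt : ∀ {n} → (Fin n → ℕ) → Fin n → Fin n → Bool
valueLt w a b = w a <ᵇ w b

eval≡evalWith : ∀ {n k} (σ : Perm n) (φ : Formula k) ρ → eval σ φ ρ ≡ evalWith posLt (valueLt (val σ)) φ ρ
eval≡evalWith σ (x <P y) ρ = refl
eval≡evalWith σ (x <V y) ρ = refl
eval≡evalWith σ (x ≐ y)  ρ = refl
eval≡evalWith σ ⊥f       ρ = refl
eval≡evalWith σ (¬f φ)   ρ = cong not (eval≡evalWith σ φ ρ)
eval≡evalWith σ (φ ∧f ψ) ρ = cong₂ _∧_ (eval≡evalWith σ φ ρ) (eval≡evalWith σ ψ ρ)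
eval≡evalWith σ (φ ∨f ψ) ρ = cong₂ _∨_ (eval≡evalWith σ φ ρ) (eval≡evalWith σ ψ ρ)
eval≡evalWith σ (∀f φ)   ρ = all-cong (allFin _) (λ a → eval≡evalWith σ φ (a ∷v ρ))
eval≡evalWith σ (∃f φ)   ρ = any-cong (allFin _) (λ a → eval≡evalWith σ φ (a ∷v ρ))

ext : ∀ {j k} → (Fin j → Fin k) → Fin (suc j) → Fin (suc k)
ext r zero    = zero
ext r (suc i) = suc (r i)

rename : ∀ {j k} → (Fin j → Fin k) → Formula j → Formula k
rename r (x <P y) = r x <P r y
rename r (x <V y) = r x <V r y
rename r (x ≐ y)  = r x ≐ r y
rename r ⊥f       = ⊥f
rename r (¬f φ)   = ¬f rename r φ
rename r (φ ∧f ψ) = rename r φ ∧f rename r ψ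
rename r (φ ∨f ψ) = rename r φ ∨f rename r ψ
rename r (∀f φ)   = ∀f (rename (ext r) φ)
rename r (∃f φ)   = ∃f (rename (ext r) φ)

lookup-ext : ∀ {A : Set} {j k} (r : Fin j → Fin k) {ρ : Vec A j} {ρ′ : Vec A k} →
  (∀ i → lookup ρ′ (r i) ≡ lookup ρ i) → ∀ a i → lookup (a ∷v ρ′) (ext r i) ≡ lookup (a ∷v ρ) i
lookup-ext r h a zero    = refl
lookup-ext r h a (suc i) = h i

evalWith-rename : ∀ {n j k} P V (r : Fin j → Fin k) (φ : Formula j) (ρ : Vec (Fin n) j) (ρ′ : Vec (Fin n) k) →
  (∀ i → lookup ρ′ (r i) ≡ lookup ρ i) → evalWith P V (rename r φ) ρ′ ≡ evalWith P V φ ρ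
evalWith-rename P V r (x <P y) ρ ρ′ h = cong₂ P (h x) (h y)
evalWith-rename P V r (x <V y) ρ ρ′ h = cong₂ V (h x) (h y)
evalWith-rename P V r (x ≐ y)  ρ ρ′ h = cong₂ (λ a b → toℕ a ≡ᵇ toℕ b) (h x) (h y)
evalWith-rename P V r ⊥f       ρ ρ′ h = refl
evalWith-rename P V r (¬f φ)   ρ ρ′ h = cong not (evalWith-rename P V r φ ρ ρ′ h)
evalWith-rename P V r (φ ∧f ψ) ρ ρ′ h =
  cong₂ _∧_ (evalWith-rename P V r φ ρ ρ′ h) (evalWith-rename P V r ψ ρ ρ′ h)
evalWith-rename P V r (φ ∨f ψ) ρ ρ′ h =
  cong₂ _∨_ (evalWith-rename P V r φ ρ ρ′ h) (evalWith-rename P V r ψ ρ ρ′ h)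
evalWith-rename P V r (∀f φ)   ρ ρ′ h =
  all-cong (allFin _) (λ a → evalWith-rename P V (ext r) φ (a ∷v ρ) (a ∷v ρ′) (lookup-ext r h a))
evalWith-rename P V r (∃f φ)   ρ ρ′ h =
  any-cong (allFin _) (λ a → evalWith-rename P V (ext r) φ (a ∷v ρ) (a ∷v ρ′) (lookup-ext r h a))

args₂ : ∀ {k} → Fin k → Fin k → Fin 2 → Fin k
args₂ x y zero       = x
args₂ x y (suc zero) = y

evalWith-args₂ : ∀ {n k P V} (x y : Fin k) (φ : Formula 2) (ρ : Vec (Fin n) k) →
  evalWith P V (rename (args₂ x y) φ) ρ ≡ evalWith P V φ (lookup ρ x ∷v lookup ρ y ∷v []v)
evalWith-args₂ {P = P} {V} x y φ ρ = evalWith-rename P V (args₂ x y) φ _ ρ λ { zero → refl ; (suc zero) → refl }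

substPos : ∀ {k} → Formula 2 → Formula k → Formula k
substPos Φ (x <P y) = rename (args₂ x y) Φ
substPos Φ (x <V y) = x <V y
substPos Φ (x ≐ y)  = x ≐ y
substPos Φ ⊥f       = ⊥f
substPos Φ (¬f φ)   = ¬f substPos Φ φ
substPos Φ (φ ∧f ψ) = substPos Φ φ ∧f substPos Φ ψ
substPos Φ (φ ∨f ψ) = substPos Φ φ ∨f substPos Φ ψ
substPos Φ (∀f φ)   = ∀f (substPos Φ φ)
substPos Φ (∃f φ)   = ∃f (substPos Φ φ)

evalWith-substPos : ∀ {n k} P V (Φ : Formula 2) (φ : Formula k) (ρ : Vec (Fin n) k) →
  evalWith P V (substPos Φ φ) ρ ≡ evalWith (λ a b → evalWith P V Φ (a ∷v b ∷v []v)) V φ ρ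
evalWith-substPos P V Φ (x <P y) ρ = evalWith-rename P V (args₂ x y) Φ _ ρ lookup-args₂
  where lookup-args₂ : ∀ i → lookup ρ (args₂ x y i) ≡ lookup (lookup ρ x ∷v lookup ρ y ∷v []v) i
        lookup-args₂ zero       = refl
        lookup-args₂ (suc zero) = refl
evalWith-substPos P V Φ (x <V y) ρ = refl
evalWith-substPos P V Φ (x ≐ y)  ρ = refl
evalWith-substPos P V Φ ⊥f       ρ = refl
evalWith-substPos P V Φ (¬f φ)   ρ = cong not (evalWith-substPos P V Φ φ ρ)
evalWith-substPos P V Φ (φ ∧f ψ) ρ = cong₂ _∧_ (evalWith-substPos P V Φ φ ρ) (evalWith-substPos P V Φ ψ ρ)
evalWith-substPos P V Φ (φ ∨f ψ) ρ = cong₂ _∨_ (evalWith-substPos P V Φ φ ρ) (evalWith-substPos P V Φ ψ ρ)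
evalWith-substPos P V Φ (∀f φ)   ρ = all-cong (allFin _) (λ a → evalWith-substPos P V Φ φ (a ∷v ρ))
evalWith-substPos P V Φ (∃f φ)   ρ = any-cong (allFin _) (λ a → evalWith-substPos P V Φ φ (a ∷v ρ))

module Isomorphism {n : ℕ} (P V P′ V′ : Fin n → Fin n → Bool) (f : Fin n → Fin n)
  (f-P : ∀ a b → P′ (f a) (f b) ≡ P a b) (f-V : ∀ a b → V′ (f a) (f b) ≡ V a b)
  (f-inj : ∀ a b → f a ≡ f b → a ≡ b) (f-surj : ∀ i → Σ (Fin n) λ a → f a ≡ i) where

  ≡ᵇ-preserved : ∀ a b → (toℕ (f a) ≡ᵇ toℕ (f b)) ≡ (toℕ a ≡ᵇ toℕ b)
  ≡ᵇ-preserved a b = bool-ext (λ e → ≡⇒≡ᵇ-true (cong toℕ (f-inj a b (toℕ-injective (≡ᵇ-true⇒≡ e)))))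
                              (λ e → ≡⇒≡ᵇ-true (cong (toℕ ∘ f) (toℕ-injective (≡ᵇ-true⇒≡ e))))

  all-reindex : (q : Fin n → Bool) → all q (allFin n) ≡ all (q ∘ f) (allFin n)
  all-reindex q = bool-ext (λ e → all-allFin⁺ _ (all-allFin⁻ q e ∘ f))
    (λ e → all-allFin⁺ _ (λ i → subst (λ z → q z ≡ true) (proj₂ (f-surj i)) (all-allFin⁻ _ e (proj₁ (f-surj i)))))

  any-reindex : (q : Fin n → Bool) → any q (allFin n) ≡ any (q ∘ f) (allFin n)
  any-reindex q = bool-ext
    (λ e → let (i , qi) = any-allFin⁻ q e in
           any-allFin⁺ _ (proj₁ (f-surj i)) (subst (λ z → q z ≡ true) (sym (proj₂ (f-surj i))) qi))
    (λ e → let (a , qa) = any-allFin⁻ _ e in any-allFin⁺ q (f a) qa)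

  evalWith-iso : ∀ {k} (φ : Formula k) (ρ : Vec (Fin n) k) → evalWith P′ V′ φ (vmap f ρ) ≡ evalWith P V φ ρ
  evalWith-iso (x <P y) ρ rewrite lookup-map x f ρ | lookup-map y f ρ = f-P _ _
  evalWith-iso (x <V y) ρ rewrite lookup-map x f ρ | lookup-map y f ρ = f-V _ _
  evalWith-iso (x ≐ y)  ρ rewrite lookup-map x f ρ | lookup-map y f ρ = ≡ᵇ-preserved _ _
  evalWith-iso ⊥f       ρ = refl
  evalWith-iso (¬f φ)   ρ = cong not (evalWith-iso φ ρ)
  evalWith-iso (φ ∧f ψ) ρ = cong₂ _∧_ (evalWith-iso φ ρ) (evalWith-iso ψ ρ)
  evalWith-iso (φ ∨f ψ) ρ = cong₂ _∨_ (evalWith-iso φ ρ) (evalWith-iso ψ ρ)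
  evalWith-iso (∀f φ)   ρ = trans (all-reindex _) (all-cong (allFin _) (λ a → evalWith-iso φ (a ∷v ρ)))
  evalWith-iso (∃f φ)   ρ = trans (any-reindex _) (any-cong (allFin _) (λ a → evalWith-iso φ (a ∷v ρ)))

Precedes-here : ∀ {l x y} → y ∈ l → Precedes (x ∷ l) x y
Precedes-here m with ∈-∃++ m
... | vs , ws , e = [] , vs , ws , cong (_ ∷_) e

Precedes-there : ∀ {a l x y} → Precedes l x y → Precedes (a ∷ l) x y
Precedes-there {a} (us , vs , ws , e) = a ∷ us , vs , ws , cong (a ∷_) e

Precedes-∷⁻ : ∀ {a l x y} → Precedes (a ∷ l) x y → (x ≡ a × y ∈ l) ⊎ Precedes l x y
Precedes-∷⁻ ([] , vs , ws , refl)     = inj₁ (refl , ∈-++⁺ʳ vs (here refl))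
Precedes-∷⁻ (u ∷ us , vs , ws , refl) = inj₂ (us , vs , ws , refl)

¬Precedes-[] : ∀ {x y} → ¬ Precedes [] x y
¬Precedes-[] ([] , _ , _ , ())
¬Precedes-[] (_ ∷ _ , _ , _ , ())

Precedes⇒rel : ∀ {R : ℕ → ℕ → Set} {l x y} → AllPairs R l → Precedes l x y → R x y
Precedes⇒rel [] p = ⊥-elim (¬Precedes-[] p)
Precedes⇒rel (h ∷ t) p with Precedes-∷⁻ p
... | inj₁ (refl , m) = All.lookup h m
... | inj₂ q          = Precedes⇒rel t q

rel⇒Precedes : ∀ {R : ℕ → ℕ → Set} {l x y} → (∀ {a} → ¬ R a a) → (∀ {a b} → R a b → ¬ R b a) →
  AllPairs R l → x ∈ l → y ∈ l → R x y → Precedes l x y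
rel⇒Precedes irr asym (h ∷ t) (here refl) (here refl) r = ⊥-elim (irr r)
rel⇒Precedes irr asym (h ∷ t) (here refl) (there my)  r = Precedes-here my
rel⇒Precedes irr asym (h ∷ t) (there mx)  (here refl) r = ⊥-elim (asym r (All.lookup h mx))
rel⇒Precedes irr asym (h ∷ t) (there mx)  (there my)  r = Precedes-there (rel⇒Precedes irr asym t mx my r)

Precedes-≡ : ∀ {l l′ x x′ y y′} → l ≡ l′ → x ≡ x′ → y ≡ y′ → Iff (Precedes l x y) (Precedes l′ x′ y′)
Precedes-≡ refl refl refl = iff-refl

_<ₗₑₓ_ : ℕ × ℕ → ℕ × ℕ → Set
(t , v) <ₗₑₓ (t′ , v′) = t < t′ ⊎ (t ≡ t′ × v < v′)

KeyLt : (ℕ → ℕ) → ℕ → ℕ → Set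
KeyLt key a b = (key a , a) <ₗₑₓ (key b , b)

KeyLt-irrefl : ∀ {key a} → ¬ KeyLt key a a
KeyLt-irrefl (inj₁ p)       = <-irrefl refl p
KeyLt-irrefl (inj₂ (_ , p)) = <-irrefl refl p

KeyLt-asym : ∀ {key a b} → KeyLt key a b → ¬ KeyLt key b a
KeyLt-asym (inj₁ p)       (inj₁ q)        = <-asym p q
KeyLt-asym (inj₁ p)       (inj₂ (e , q))  = <-irrefl (sym e) p
KeyLt-asym (inj₂ (e , p)) (inj₁ q)        = <-irrefl (sym e) q
KeyLt-asym (inj₂ (e , p)) (inj₂ (e′ , q)) = <-asym p q

SortedBy : (ℕ → ℕ) → List ℕ → Set
SortedBy key = AllPairs (KeyLt key)

SortedBy-Precedes⁺ : ∀ {key l x y} → SortedBy key l → x ∈ l → y ∈ l → KeyLt key x y → Precedes l x y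
SortedBy-Precedes⁺ {key} = rel⇒Precedes (KeyLt-irrefl {key}) (KeyLt-asym {key})

AllPairs-++⁻ˡ : ∀ {R : ℕ → ℕ → Set} xs {ys} → AllPairs R (xs ++ ys) → AllPairs R xs
AllPairs-++⁻ˡ []       p       = []
AllPairs-++⁻ˡ (x ∷ xs) (h ∷ t) = AllP.++⁻ˡ xs h ∷ AllPairs-++⁻ˡ xs t

AllPairs-++⁻ʳ : ∀ {R : ℕ → ℕ → Set} xs {ys} → AllPairs R (xs ++ ys) → AllPairs R ys
AllPairs-++⁻ʳ []       p       = p
AllPairs-++⁻ʳ (x ∷ xs) (h ∷ t) = AllPairs-++⁻ʳ xs t

AllPairs-mono-on : ∀ {R R′ : ℕ → ℕ → Set} {P : ℕ → Set} {l} →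
  (∀ {a b} → P a → P b → R a b → R′ a b) → All P l → AllPairs R l → AllPairs R′ l
AllPairs-mono-on f []       []      = []
AllPairs-mono-on f (p ∷ ps) (h ∷ t) = All.zipWith (λ (r , q) → f p q r) (h , ps) ∷ AllPairs-mono-on f ps t

KeyLt-cong : ∀ {K K′ a b} → K′ a ≡ K a → K′ b ≡ K b → KeyLt K′ a b → KeyLt K a b
KeyLt-cong {a = a} {b} = subst₂ (λ ka kb → (ka , a) <ₗₑₓ (kb , b))

SortedBy-cong : ∀ {K K′ l} → SortedBy K′ l → (∀ {u} → u ∈ l → K′ u ≡ K u) → SortedBy K l
SortedBy-cong s e = AllPairs-mono-on KeyLt-cong (All.tabulate e) s

SortedBy-constKey : ∀ {K k l} → AllPairs _<_ l → (∀ {u} → u ∈ l → K u ≡ k) → SortedBy K l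
SortedBy-constKey inc e = AllPairs-mono-on (λ ea eb p → inj₂ (trans ea (sym eb) , p)) (All.tabulate e) inc

SortedBy-++ : ∀ {K l₁ l₂} → SortedBy K l₁ → SortedBy K l₂ →
  (∀ {a b} → a ∈ l₁ → b ∈ l₂ → KeyLt K a b) → SortedBy K (l₁ ++ l₂)
SortedBy-++ s₁ s₂ f = APP.++⁺ s₁ s₂ (All.tabulate (λ ma → All.tabulate (f ma)))

SortedBy-∷ : ∀ {K x l} → (∀ {b} → b ∈ l → K x < K b) → SortedBy K l → SortedBy K (x ∷ l)
SortedBy-∷ f s = All.tabulate (inj₁ ∘ f) ∷ s

SortedBy-emit : ∀ {K K′ : ℕ → ℕ} {k y l} → K y ≡ k → (∀ u → suc k ≤ K′ u) →
  (∀ {u} → u ∈ l → K′ u ≡ K u) → SortedBy K′ l → SortedBy K (y ∷ l)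
SortedBy-emit Ky≡k K′≥ e s =
  SortedBy-∷ (λ {u} u∈l → subst₂ _<_ (sym Ky≡k) (e u∈l) (K′≥ u)) (SortedBy-cong s e)

SortedBy-distinct : ∀ {K l} → SortedBy K l → AllPairs _≢_ l
SortedBy-distinct {K} = AllPairs.map (λ {a} {b} r e → KeyLt-irrefl {K} {b} (subst (λ z → KeyLt K z b) e r))

≮∧≢⇒> : ∀ {a b} → ¬ a < b → a ≢ b → b < a
≮∧≢⇒> a≮b a≢b = ≤∧≢⇒< (≮⇒≥ a≮b) (a≢b ∘ sym)

All-∉-∷ : ∀ {x : ℕ} {o r xs} → All (x ≢_) xs → All (_∉ o ++ r) xs → All (_∉ x ∷ r) xs
All-∉-∷ {o = o} x∉xs xs∉or = All.zipWith (λ { (x≢u , u∉or) (here u≡x) → x≢u (sym u≡x)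
                                           ; (x≢u , u∉or) (there u∈r) → u∉or (∈-++⁺ʳ o u∈r) }) (x∉xs , xs∉or)

-- Stack sorting

firstIndexFrom : ℕ → (ℕ → Bool) → List ℕ → ℕ
firstIndexFrom k p []       = k
firstIndexFrom k p (x ∷ xs) = if p x then k else firstIndexFrom (suc k) p xs

firstIndexFrom-≥ : ∀ k p xs → k ≤ firstIndexFrom k p xs
firstIndexFrom-≥ k p []       = ≤-refl
firstIndexFrom-≥ k p (x ∷ xs) with p x
... | true  = ≤-refl
... | false = ≤-trans (n≤1+n k) (firstIndexFrom-≥ (suc k) p xs)

firstIndexFrom-≤ : ∀ k p xs → firstIndexFrom k p xs ≤ k + length xs
firstIndexFrom-≤ k p []       = ≤-reflexive (sym (+-identityʳ k))
firstIndexFrom-≤ k p (x ∷ xs) with p x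
... | true  = m≤m+n k _
... | false = subst (firstIndexFrom (suc k) p xs ≤_) (sym (+-suc k _)) (firstIndexFrom-≤ (suc k) p xs)

firstIndexFrom-here : ∀ k p x xs → p x ≡ true → firstIndexFrom k p (x ∷ xs) ≡ k
firstIndexFrom-here k p x xs e rewrite e = refl

firstIndexFrom-there : ∀ k p x xs → p x ≡ false → firstIndexFrom k p (x ∷ xs) ≡ firstIndexFrom (suc k) p xs
firstIndexFrom-there k p x xs e rewrite e = refl

-- The output time of an entry is the index (counted from k) of the input entry
-- being read when it is output; the final flush happens at time k + length.
-- An entry leaves the stack when the first later, larger entry is read.
stackTime : ℕ → List ℕ → ℕ → ℕ
stackTime k []       u = k
stackTime k (x ∷ xs) u = if u ≡ᵇ x then firstIndexFrom (suc k) (x <ᵇ_) xs else stackTime (suc k) xs u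

stackTime-≥ : ∀ k xs u → k ≤ stackTime k xs u
stackTime-≥ k []       u = ≤-refl
stackTime-≥ k (x ∷ xs) u with u ≡ᵇ x
... | true  = ≤-trans (n≤1+n k) (firstIndexFrom-≥ (suc k) _ xs)
... | false = ≤-trans (n≤1+n k) (stackTime-≥ (suc k) xs u)

stackTime-≤ : ∀ k xs u → stackTime k xs u ≤ k + length xs
stackTime-≤ k []       u = ≤-reflexive (sym (+-identityʳ k))
stackTime-≤ k (x ∷ xs) u with u ≡ᵇ x
... | true  = subst (firstIndexFrom (suc k) (x <ᵇ_) xs ≤_) (sym (+-suc k _)) (firstIndexFrom-≤ (suc k) (x <ᵇ_) xs)
... | false = subst (stackTime (suc k) xs u ≤_) (sym (+-suc k _)) (stackTime-≤ (suc k) xs u)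

stackTime-head : ∀ k x xs → stackTime k (x ∷ xs) x ≡ firstIndexFrom (suc k) (x <ᵇ_) xs
stackTime-head k x xs rewrite ≡ᵇ-refl x = refl

stackTime-tail : ∀ k x xs u → u ≢ x → stackTime k (x ∷ xs) u ≡ stackTime (suc k) xs u
stackTime-tail k x xs u u≢x rewrite ≢⇒≡ᵇ-false u≢x = refl

stackTimeFrom : ℕ → List ℕ → List ℕ → ℕ → ℕ
stackTimeFrom k st xs u = if does (u ∈? st) then firstIndexFrom k (u <ᵇ_) xs else stackTime k xs u

stackTimeFrom-stack : ∀ {k st xs u} → u ∈ st → stackTimeFrom k st xs u ≡ firstIndexFrom k (u <ᵇ_) xs
stackTimeFrom-stack {st = st} {u = u} u∈st rewrite dec-true (u ∈? st) u∈st = refl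

stackTimeFrom-input : ∀ {k st xs u} → u ∉ st → stackTimeFrom k st xs u ≡ stackTime k xs u
stackTimeFrom-input {st = st} {u = u} u∉st rewrite dec-false (u ∈? st) u∉st = refl

stackTimeFrom-≥ : ∀ k st xs u → k ≤ stackTimeFrom k st xs u
stackTimeFrom-≥ k st xs u with does (u ∈? st)
... | true  = firstIndexFrom-≥ k _ xs
... | false = stackTime-≥ k xs u

splitLt-spec : ∀ x q → AllPairs _<_ q → x ∉ q →
  ∃ λ s → ∃ λ r → splitLt x q ≡ (s , r) × q ≡ s ++ r × All (_< x) s × All (x <_) r
splitLt-spec x []      inc       x∉q = [] , [] , refl , refl , [] , []
splitLt-spec x (t ∷ q) (h ∷ inc) x∉q with t <ᵇ x in t<ᵇx
... | true with splitLt x q | splitLt-spec x q inc (x∉q ∘ there)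
...   | .(s , r) | s , r , refl , refl , s<x , x<r = t ∷ s , r , refl , refl , <ᵇ-true⇒< t<ᵇx ∷ s<x , x<r
splitLt-spec x (t ∷ q) (h ∷ inc) x∉q | false =
  [] , t ∷ q , refl , refl , [] , (x<t ∷ All.map (<-trans x<t) h)
  where x<t = ≮∧≢⇒> (false⇒¬true t<ᵇx ∘ <⇒<ᵇ-true) (x∉q ∘ here ∘ sym)

stackPush-splitLt : ∀ x st → stackPush x st ≡ (proj₁ (splitLt x st) , x ∷ proj₂ (splitLt x st))
stackPush-splitLt x []       = refl
stackPush-splitLt x (t ∷ st) with t <ᵇ x
... | false = refl
... | true with stackPush x st | splitLt x st | stackPush-splitLt x st
...   | ._ | s , r | refl = refl

module StackStep {k : ℕ} {x o r xs} (o<x : All (_< x) o) (x<r : All (x <_) r) (x∉or : x ∉ o ++ r)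
  (x∉xs : All (x ≢_) xs) (xs∉or : All (_∉ o ++ r) xs) where

  time-popped : ∀ {u} → u ∈ o → stackTimeFrom k (o ++ r) (x ∷ xs) u ≡ k
  time-popped {u} u∈o = trans (stackTimeFrom-stack {k} {o ++ r} {x ∷ xs} (∈-++⁺ˡ u∈o))
                              (firstIndexFrom-here k (u <ᵇ_) x xs (<⇒<ᵇ-true (All.lookup o<x u∈o)))

  time-later : ∀ {u} → u ∈ x ∷ r ++ xs → stackTimeFrom (suc k) (x ∷ r) xs u ≡ stackTimeFrom k (o ++ r) (x ∷ xs) u
  time-later (here refl) = trans (stackTimeFrom-stack {suc k} {x ∷ r} {xs} (here refl))
    (sym (trans (stackTimeFrom-input {k} {o ++ r} {x ∷ xs} x∉or) (stackTime-head k x xs)))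
  time-later {u} (there m) with ∈-++⁻ r m
  ... | inj₁ u∈r = trans (stackTimeFrom-stack {suc k} {x ∷ r} {xs} (there u∈r))
    (sym (trans (stackTimeFrom-stack {k} {o ++ r} {x ∷ xs} (∈-++⁺ʳ o u∈r))
                (firstIndexFrom-there k (u <ᵇ_) x xs (≮⇒<ᵇ-false (<-asym (All.lookup x<r u∈r))))))
  ... | inj₂ u∈xs = trans (stackTimeFrom-input {suc k} {x ∷ r} {xs} (All.lookup (All-∉-∷ x∉xs xs∉or) u∈xs))
    (sym (trans (stackTimeFrom-input {k} {o ++ r} {x ∷ xs} (All.lookup xs∉or u∈xs))
                (stackTime-tail k x xs u (All.lookup x∉xs u∈xs ∘ sym))))

-- The stack is kept increasing from the top; a push outputs the entries smaller
-- than the new one, all at the current time, and they precede everything later.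
stackRun-sorted : ∀ xs k st → AllPairs _<_ st → AllPairs _≢_ xs → All (_∉ st) xs →
  SortedBy (stackTimeFrom k st xs) (stackRun st xs) × (stackRun st xs ↭ st ++ xs)
stackRun-sorted [] k st inc _ _ =
  SortedBy-constKey inc (stackTimeFrom-stack {k} {st} {[]}) , ↭-reflexive (sym (++-identityʳ st))
stackRun-sorted (x ∷ xs) k st inc (x∉xs ∷ xs-distinct) (x∉st ∷ xs∉st) with splitLt-spec x st inc x∉st
... | o , r , split≡ , refl , o<x , x<r rewrite stackPush-splitLt x (o ++ r) | split≡ =
  SortedBy-++ (SortedBy-constKey (AllPairs-++⁻ˡ o inc) time-popped) (SortedBy-cong sorted (time-later ∘ ∈-resp-↭ perm))
    (λ {a} {b} a∈o b∈rest → inj₁ (subst₂ _<_ (sym (time-popped a∈o)) (time-later (∈-resp-↭ perm b∈rest))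
                                                (stackTimeFrom-≥ (suc k) (x ∷ r) xs b))) ,
  ↭-trans (++⁺ˡ o perm) (↭-trans (++⁺ˡ o (↭-sym (shift x r xs))) (↭-reflexive (sym (++-assoc o r (x ∷ xs)))))
  where
  open StackStep {k} {x} {o} {r} {xs} o<x x<r x∉st x∉xs xs∉st
  IH = stackRun-sorted xs (suc k) (x ∷ r) (x<r ∷ AllPairs-++⁻ʳ o inc) xs-distinct (All-∉-∷ x∉xs xs∉st)
  sorted = proj₁ IH
  perm = proj₂ IH

stackSort-sorted : ∀ L → AllPairs _≢_ L → SortedBy (stackTime 0 L) (stackSort L) × (stackSort L ↭ L)
stackSort-sorted L distinct = stackRun-sorted L 0 [] [] distinct (All.universal (λ _ ()) L)

-- Bubble sort

<⇒⊔≡ʳ : ∀ {m x} → m < x → m ⊔ x ≡ x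
<⇒⊔≡ʳ p = m≤n⇒m⊔n≡n (<⇒≤ p)

≮⇒⊔≡ˡ : ∀ {m x} → ¬ m < x → m ⊔ x ≡ m
≮⇒⊔≡ˡ p = m≥n⇒m⊔n≡m (≮⇒≥ p)

≮⇒⊔≡ʳ : ∀ {m x} → ¬ x < m → m ⊔ x ≡ x
≮⇒⊔≡ʳ p = m≤n⇒m⊔n≡n (≮⇒≥ p)

<-⊔⁻ : ∀ {m x y} → y < m ⊔ x → y < m ⊎ y < x
<-⊔⁻ {m} {x} p with ⊔-sel m x
... | inj₁ e = inj₁ (subst (_ <_) e p)
... | inj₂ e = inj₂ (subst (_ <_) e p)

-- m is the maximum of the entries read so far: a smaller entry is output at
-- once, any other one waits in the buffer for the next larger entry.
bubbleTime : ℕ → ℕ → List ℕ → ℕ → ℕ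
bubbleTime k m []       u = k
bubbleTime k m (x ∷ xs) u =
  if u ≡ᵇ x then (if x <ᵇ m then k else firstIndexFrom (suc k) (x <ᵇ_) xs) else bubbleTime (suc k) (m ⊔ x) xs u

bubbleTime-≥ : ∀ k m xs u → k ≤ bubbleTime k m xs u
bubbleTime-≥ k m []       u = ≤-refl
bubbleTime-≥ k m (x ∷ xs) u with u ≡ᵇ x
... | false = ≤-trans (n≤1+n k) (bubbleTime-≥ (suc k) (m ⊔ x) xs u)
... | true with x <ᵇ m
...   | true  = ≤-refl
...   | false = ≤-trans (n≤1+n k) (firstIndexFrom-≥ (suc k) _ xs)

bubbleTime-≤ : ∀ k m xs u → bubbleTime k m xs u ≤ k + length xs
bubbleTime-≤ k m []       u = ≤-reflexive (sym (+-identityʳ k))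
bubbleTime-≤ k m (x ∷ xs) u with u ≡ᵇ x
... | false = subst (bubbleTime (suc k) (m ⊔ x) xs u ≤_) (sym (+-suc k _)) (bubbleTime-≤ (suc k) (m ⊔ x) xs u)
... | true with x <ᵇ m
...   | true  = m≤m+n k _
...   | false = subst (firstIndexFrom (suc k) (x <ᵇ_) xs ≤_) (sym (+-suc k _)) (firstIndexFrom-≤ (suc k) (x <ᵇ_) xs)

bubbleTimeFrom : ℕ → ℕ → List ℕ → ℕ → ℕ
bubbleTimeFrom k b xs u = if u ≡ᵇ b then firstIndexFrom k (b <ᵇ_) xs else bubbleTime k b xs u

bubbleTimeFrom-≥ : ∀ k b xs u → k ≤ bubbleTimeFrom k b xs u
bubbleTimeFrom-≥ k b xs u with u ≡ᵇ b
... | true  = firstIndexFrom-≥ k _ xs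
... | false = bubbleTime-≥ k b xs u

bubbleRun-smaller : ∀ {x b} xs → x < b → bubbleRun b (x ∷ xs) ≡ x ∷ bubbleRun b xs
bubbleRun-smaller xs x<b rewrite <⇒<ᵇ-true x<b = refl

bubbleRun-larger : ∀ {x b} xs → ¬ x < b → bubbleRun b (x ∷ xs) ≡ b ∷ bubbleRun x xs
bubbleRun-larger xs x≮b rewrite ≮⇒<ᵇ-false x≮b = refl

-- The buffer always holds the maximum of the entries read so far.
bubbleRun-sorted : ∀ xs k b → b ∉ xs → AllPairs _≢_ xs →
  SortedBy (bubbleTimeFrom k b xs) (bubbleRun b xs) × (bubbleRun b xs ↭ b ∷ xs)
bubbleRun-sorted []       k b _    _ = ([] ∷ []) , ↭-refl
bubbleRun-sorted (x ∷ xs) k b b∉xs (x∉xs ∷ xs-distinct) with x <? b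
... | yes x<b rewrite bubbleRun-smaller xs x<b =
  SortedBy-emit time-x (bubbleTimeFrom-≥ (suc k) b xs) (time-later ∘ ∈-resp-↭ perm) sorted ,
  ↭-trans (prep x perm) (swap x b ↭-refl)
  where
  b≢x = b∉xs ∘ here
  IH = bubbleRun-sorted xs (suc k) b (b∉xs ∘ there) xs-distinct
  sorted = proj₁ IH
  perm = proj₂ IH
  time-x : bubbleTimeFrom k b (x ∷ xs) x ≡ k
  time-x rewrite ≢⇒≡ᵇ-false (b≢x ∘ sym) | ≡ᵇ-refl x | <⇒<ᵇ-true x<b = refl
  time-later : ∀ {u} → u ∈ b ∷ xs → bubbleTimeFrom (suc k) b xs u ≡ bubbleTimeFrom k b (x ∷ xs) u
  time-later (here refl) rewrite ≡ᵇ-refl b | ≮⇒<ᵇ-false (<-asym x<b) = refl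
  time-later {u} (there u∈xs)
    rewrite ≢⇒≡ᵇ-false {u} {b} (λ { refl → b∉xs (there u∈xs) })
          | ≢⇒≡ᵇ-false {u} {x} (All.lookup x∉xs u∈xs ∘ sym) | ≮⇒⊔≡ˡ (<-asym x<b) = refl
... | no x≮b rewrite bubbleRun-larger xs x≮b =
  SortedBy-emit time-b (bubbleTimeFrom-≥ (suc k) x xs) (time-later ∘ ∈-resp-↭ perm) sorted , prep b perm
  where
  b≢x = b∉xs ∘ here
  b<x = ≮∧≢⇒> x≮b (b≢x ∘ sym)
  IH = bubbleRun-sorted xs (suc k) x (λ x∈xs → All.lookup x∉xs x∈xs refl) xs-distinct
  sorted = proj₁ IH
  perm = proj₂ IH
  time-b : bubbleTimeFrom k b (x ∷ xs) b ≡ k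
  time-b rewrite ≡ᵇ-refl b | <⇒<ᵇ-true b<x = refl
  time-later : ∀ {u} → u ∈ x ∷ xs → bubbleTimeFrom (suc k) x xs u ≡ bubbleTimeFrom k b (x ∷ xs) u
  time-later (here refl) rewrite ≡ᵇ-refl x | ≢⇒≡ᵇ-false (b≢x ∘ sym) | ≮⇒<ᵇ-false x≮b = refl
  time-later {u} (there u∈xs)
    rewrite ≢⇒≡ᵇ-false {u} {x} (All.lookup x∉xs u∈xs ∘ sym)
          | ≢⇒≡ᵇ-false {u} {b} (λ { refl → b∉xs (there u∈xs) }) | <⇒⊔≡ʳ b<x = refl

bubbleSort-sorted : ∀ L → AllPairs _≢_ L → SortedBy (bubbleTime 0 0 L) (bubbleSort L) × (bubbleSort L ↭ L)
bubbleSort-sorted []       _ = [] , ↭-refl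
bubbleSort-sorted (x ∷ xs) (x∉xs ∷ xs-distinct) =
  SortedBy-cong (proj₁ IH) (time-start ∘ ∈-resp-↭ (proj₂ IH)) , proj₂ IH
  where
  IH = bubbleRun-sorted xs 1 x (λ x∈xs → All.lookup x∉xs x∈xs refl) xs-distinct
  time-start : ∀ {u} → u ∈ x ∷ xs → bubbleTimeFrom 1 x xs u ≡ bubbleTime 0 0 (x ∷ xs) u
  time-start (here refl) rewrite ≡ᵇ-refl x | ≮⇒<ᵇ-false {x} {0} (λ ()) = refl
  time-start {u} (there u∈xs) rewrite ≢⇒≡ᵇ-false {u} {x} (All.lookup x∉xs u∈xs ∘ sym) | ⊔-identityˡ x = refl

-- Queue and bypass

-- A queued entry u leaves when an entry x with u < x < m is read, m being the
-- maximum so far, which sits at the back of the queue.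
queuedTime : ℕ → ℕ → ℕ → List ℕ → ℕ
queuedTime k m u []       = k
queuedTime k m u (x ∷ xs) = if (u <ᵇ x) ∧ (x <ᵇ m) then k else queuedTime (suc k) (m ⊔ x) u xs

queuedTime-≥ : ∀ k m u xs → k ≤ queuedTime k m u xs
queuedTime-≥ k m u []       = ≤-refl
queuedTime-≥ k m u (x ∷ xs) with (u <ᵇ x) ∧ (x <ᵇ m)
... | true  = ≤-refl
... | false = ≤-trans (n≤1+n k) (queuedTime-≥ (suc k) (m ⊔ x) u xs)

queuedTime-≤ : ∀ k m u xs → queuedTime k m u xs ≤ k + length xs
queuedTime-≤ k m u []       = ≤-reflexive (sym (+-identityʳ k))
queuedTime-≤ k m u (x ∷ xs) with (u <ᵇ x) ∧ (x <ᵇ m)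
... | true  = m≤m+n k _
... | false = subst (queuedTime (suc k) (m ⊔ x) u xs ≤_) (sym (+-suc k _)) (queuedTime-≤ (suc k) (m ⊔ x) u xs)

queueTime : ℕ → ℕ → List ℕ → ℕ → ℕ
queueTime k m []       u = k
queueTime k m (x ∷ xs) u =
  if u ≡ᵇ x then (if x <ᵇ m then k else queuedTime (suc k) x x xs) else queueTime (suc k) (m ⊔ x) xs u

queueTime-≥ : ∀ k m xs u → k ≤ queueTime k m xs u
queueTime-≥ k m []       u = ≤-refl
queueTime-≥ k m (x ∷ xs) u with u ≡ᵇ x
... | false = ≤-trans (n≤1+n k) (queueTime-≥ (suc k) (m ⊔ x) xs u)
... | true with x <ᵇ m
...   | true  = ≤-refl
...   | false = ≤-trans (n≤1+n k) (queuedTime-≥ (suc k) x x xs)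

queueTime-≤ : ∀ k m xs u → queueTime k m xs u ≤ k + length xs
queueTime-≤ k m []       u = ≤-reflexive (sym (+-identityʳ k))
queueTime-≤ k m (x ∷ xs) u with u ≡ᵇ x
... | false = subst (queueTime (suc k) (m ⊔ x) xs u ≤_) (sym (+-suc k _)) (queueTime-≤ (suc k) (m ⊔ x) xs u)
... | true with x <ᵇ m
...   | true  = m≤m+n k _
...   | false = subst (queuedTime (suc k) x x xs ≤_) (sym (+-suc k _)) (queuedTime-≤ (suc k) x x xs)

queueTimeFrom : ℕ → ℕ → List ℕ → List ℕ → ℕ → ℕ
queueTimeFrom k m q xs u = if does (u ∈? q) then queuedTime k m u xs else queueTime k m xs u

queueTimeFrom-≥ : ∀ k m q xs u → k ≤ queueTimeFrom k m q xs u
queueTimeFrom-≥ k m q xs u with does (u ∈? q)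
... | true  = queuedTime-≥ k m u xs
... | false = queueTime-≥ k m xs u

queueTimeFrom-queued : ∀ {k m q xs u} → u ∈ q → queueTimeFrom k m q xs u ≡ queuedTime k m u xs
queueTimeFrom-queued {q = q} {u = u} u∈q rewrite dec-true (u ∈? q) u∈q = refl

queueTimeFrom-input : ∀ {k m q xs u} → u ∉ q → queueTimeFrom k m q xs u ≡ queueTime k m xs u
queueTimeFrom-input {q = q} {u = u} u∉q rewrite dec-false (u ∈? q) u∉q = refl

record QueueInv (m : ℕ) (q : List ℕ) : Set where
  constructor queueInv
  field
    increasing : AllPairs _<_ q
    max∈       : m ∈ q
    ≤max       : All (_≤ m) q
open QueueInv

appendable-≡ : ∀ {m q} x → QueueInv m q → appendable x q ≡ (m <ᵇ x)
appendable-≡ x (queueInv inc (here refl) le) with inc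
... | [] ∷ []      = refl
... | (p ∷ _) ∷ _  = ⊥-elim (<-irrefl refl (<-≤-trans p (All.lookup le (there (here refl)))))
appendable-≡ {q = y ∷ []}     x (queueInv inc (there ()) le)
appendable-≡ {q = y ∷ z ∷ zs} x (queueInv (_ ∷ inc) (there m∈) (_ ∷ le)) = appendable-≡ x (queueInv inc m∈ le)

belowFront-All : ∀ {x q} → AllPairs _<_ q → belowFront x q ≡ true → All (x <_) q
belowFront-All {x} {y ∷ q} (h ∷ _) e = x<y ∷ All.map (<-trans x<y) h
  where x<y = <ᵇ-true⇒< e

queueRun-append : ∀ {x q} xs → appendable x q ≡ true → queueRun q (x ∷ xs) ≡ queueRun (q ++ [ x ]) xs
queueRun-append xs e rewrite e = refl

queueRun-bypass : ∀ {x q} xs → appendable x q ≡ false → belowFront x q ≡ true →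
  queueRun q (x ∷ xs) ≡ x ∷ queueRun q xs
queueRun-bypass xs e₁ e₂ rewrite e₁ | e₂ = refl

queueRun-pop : ∀ {x q s r rs} xs → appendable x q ≡ false → belowFront x q ≡ false → splitLt x q ≡ (s , r ∷ rs) →
  queueRun q (x ∷ xs) ≡ s ++ (x ∷ queueRun (r ∷ rs) xs)
queueRun-pop xs e₁ e₂ e₃ rewrite e₁ | e₂ | e₃ = refl

QueueSorted : List ℕ → ℕ → ℕ → List ℕ → Set
QueueSorted xs k m q = SortedBy (queueTimeFrom k m q xs) (queueRun q xs) × (queueRun q xs ↭ q ++ xs)

QueueSortedFrom : List ℕ → Set
QueueSortedFrom xs = ∀ k m q → QueueInv m q → All (_∉ q) xs → QueueSorted xs k m q

module QueueStep {x xs} {k : ℕ} {m q} (rec : QueueSortedFrom xs) (inv : QueueInv m q) (x∉q : x ∉ q)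
  (x∉xs : All (x ≢_) xs) (xs∉q : All (_∉ q) xs) where

  append : m < x → QueueSorted (x ∷ xs) k m q
  append m<x rewrite queueRun-append {x} {q} xs (trans (appendable-≡ x inv) (<⇒<ᵇ-true m<x)) =
    SortedBy-cong sorted (time-later ∘ ∈-resp-↭ perm) , ↭-trans perm (↭-reflexive (++-assoc q [ x ] xs))
    where
    q′ = q ++ [ x ]
    inv′ : QueueInv x q′
    inv′ = queueInv (APP.++⁺ (increasing inv) ([] ∷ []) (All.map (λ p → ≤-<-trans p m<x ∷ []) (≤max inv)))
                    (∈-++⁺ʳ q (here refl))
                    (AllP.++⁺ (All.map (λ p → <⇒≤ (≤-<-trans p m<x)) (≤max inv)) (≤-refl ∷ []))
    xs∉q′ : All (_∉ q′) xs
    xs∉q′ = All.zipWith (λ { (x≢u , u∉q) u∈q′ → [ u∉q , (λ { (here refl) → x≢u refl }) ]′ (∈-++⁻ q u∈q′) })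
                        (x∉xs , xs∉q)
    IH = rec (suc k) x q′ inv′ xs∉q′
    sorted = proj₁ IH
    perm = proj₂ IH
    time-later : ∀ {u} → u ∈ q′ ++ xs → queueTimeFrom (suc k) x q′ xs u ≡ queueTimeFrom k m q (x ∷ xs) u
    time-later {u} u∈ with ∈-++⁻ q′ u∈
    ... | inj₁ u∈q′ with ∈-++⁻ q u∈q′
    ...   | inj₁ u∈q
      rewrite queueTimeFrom-queued {suc k} {x} {q′} {xs} u∈q′ | queueTimeFrom-queued {k} {m} {q} {x ∷ xs} u∈q
            | <⇒<ᵇ-true (≤-<-trans (All.lookup (≤max inv) u∈q) m<x) | ≮⇒<ᵇ-false (<-asym m<x) | <⇒⊔≡ʳ m<x = refl
    ...   | inj₂ (here refl)
      rewrite queueTimeFrom-queued {suc k} {x} {q′} {xs} u∈q′ | queueTimeFrom-input {k} {m} {q} {x ∷ xs} x∉q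
            | ≡ᵇ-refl x | ≮⇒<ᵇ-false (<-asym m<x) = refl
    time-later {u} u∈ | inj₂ u∈xs
      rewrite queueTimeFrom-input {suc k} {x} {q′} {xs} (All.lookup xs∉q′ u∈xs)
            | queueTimeFrom-input {k} {m} {q} {x ∷ xs} (All.lookup xs∉q u∈xs)
            | ≢⇒≡ᵇ-false {u} {x} (All.lookup x∉xs u∈xs ∘ sym) | <⇒⊔≡ʳ m<x = refl

  time-x : x < m → queueTimeFrom k m q (x ∷ xs) x ≡ k
  time-x x<m rewrite queueTimeFrom-input {k} {m} {q} {x ∷ xs} x∉q | ≡ᵇ-refl x | <⇒<ᵇ-true x<m = refl

  time-input : x < m → ∀ {q′ u} → u ∈ xs → (∀ {v} → v ∈ xs → v ∉ q′) →
    queueTimeFrom (suc k) m q′ xs u ≡ queueTimeFrom k m q (x ∷ xs) u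
  time-input x<m {q′} {u} u∈xs xs∉q′
    rewrite queueTimeFrom-input {suc k} {m} {q′} {xs} (xs∉q′ u∈xs)
          | queueTimeFrom-input {k} {m} {q} {x ∷ xs} (All.lookup xs∉q u∈xs)
          | ≢⇒≡ᵇ-false {u} {x} (All.lookup x∉xs u∈xs ∘ sym) | ≮⇒⊔≡ˡ (<-asym x<m) = refl

  time-queued : x < m → ∀ {u} → u ∈ q → x < u → queueTimeFrom (suc k) m q xs u ≡ queueTimeFrom k m q (x ∷ xs) u
  time-queued x<m {u} u∈q x<u
    rewrite queueTimeFrom-queued {suc k} {m} {q} {xs} u∈q | queueTimeFrom-queued {k} {m} {q} {x ∷ xs} u∈q
                                    | ≮⇒<ᵇ-false {u} {x} (<-asym x<u) | ≮⇒⊔≡ˡ (<-asym x<m) = refl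

  bypass : x < m → belowFront x q ≡ true → QueueSorted (x ∷ xs) k m q
  bypass x<m bf rewrite queueRun-bypass {x} {q} xs (trans (appendable-≡ x inv) (≮⇒<ᵇ-false (<-asym x<m))) bf =
    SortedBy-emit (time-x x<m) (queueTimeFrom-≥ (suc k) m q xs) (time-later ∘ ∈-resp-↭ perm) sorted ,
    ↭-trans (prep x perm) (↭-sym (shift x q xs))
    where
    IH = rec (suc k) m q inv xs∉q
    sorted = proj₁ IH
    perm = proj₂ IH
    time-later : ∀ {u} → u ∈ q ++ xs → queueTimeFrom (suc k) m q xs u ≡ queueTimeFrom k m q (x ∷ xs) u
    time-later u∈ with ∈-++⁻ q u∈
    ... | inj₁ u∈q  = time-queued x<m u∈q (All.lookup (belowFront-All (increasing inv) bf) u∈q)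
    ... | inj₂ u∈xs = time-input x<m u∈xs (All.lookup xs∉q)

  pop : x < m → belowFront x q ≡ false → QueueSorted (x ∷ xs) k m q
  pop x<m bf with splitLt-spec x q (increasing inv) x∉q
  ... | s , [] , _ , refl , s<x , _ = ⊥-elim (<-asym x<m (All.lookup s<x (subst (m ∈_) (++-identityʳ s) (max∈ inv))))
  ... | s , r₀ ∷ rs , split≡ , refl , s<x , x<r
    rewrite queueRun-pop {x} {s ++ r₀ ∷ rs} xs (trans (appendable-≡ x inv) (≮⇒<ᵇ-false (<-asym x<m))) bf split≡ =
    SortedBy-++ (SortedBy-constKey (AllPairs-++⁻ˡ s (increasing inv)) time-s)
                (SortedBy-emit (time-x x<m) (queueTimeFrom-≥ (suc k) m r xs) (time-later ∘ ∈-resp-↭ perm) sorted)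
                (λ { {a} u∈s (here refl) → inj₂ (trans (time-s u∈s) (sym (time-x x<m)) , All.lookup s<x u∈s)
                   ; {a} {b} u∈s (there b∈) → inj₁ (subst (_< _) (sym (time-s u∈s))
                        (subst (suc k ≤_) (time-later (∈-resp-↭ perm b∈)) (queueTimeFrom-≥ (suc k) m r xs b))) }) ,
    ↭-trans (++⁺ˡ s (prep x perm))
            (↭-trans (++⁺ˡ s (↭-sym (shift x r xs))) (↭-reflexive (sym (++-assoc s r (x ∷ xs)))))
    where
    r = r₀ ∷ rs
    m∈r : m ∈ r
    m∈r with ∈-++⁻ s (max∈ inv)
    ... | inj₁ m∈s = ⊥-elim (<-asym x<m (All.lookup s<x m∈s))
    ... | inj₂ m∈r = m∈r
    xs∉r : All (_∉ r) xs
    xs∉r = All.map (λ u∉q u∈r → u∉q (∈-++⁺ʳ s u∈r)) xs∉q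
    IH = rec (suc k) m r (queueInv (AllPairs-++⁻ʳ s (increasing inv)) m∈r (AllP.++⁻ʳ s (≤max inv))) xs∉r
    sorted = proj₁ IH
    perm = proj₂ IH
    time-s : ∀ {u} → u ∈ s → queueTimeFrom k m (s ++ r) (x ∷ xs) u ≡ k
    time-s {u} u∈s rewrite queueTimeFrom-queued {k} {m} {s ++ r} {x ∷ xs} (∈-++⁺ˡ u∈s)
                         | <⇒<ᵇ-true (All.lookup s<x u∈s) | <⇒<ᵇ-true x<m = refl
    time-later : ∀ {u} → u ∈ r ++ xs → queueTimeFrom (suc k) m r xs u ≡ queueTimeFrom k m (s ++ r) (x ∷ xs) u
    time-later {u} u∈ with ∈-++⁻ r u∈
    ... | inj₁ u∈r
      rewrite queueTimeFrom-queued {suc k} {m} {r} {xs} u∈r | queueTimeFrom-queued {k} {m} {s ++ r} {x ∷ xs} (∈-++⁺ʳ s u∈r)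
            | ≮⇒<ᵇ-false {u} {x} (<-asym (All.lookup x<r u∈r)) | ≮⇒⊔≡ˡ (<-asym x<m) = refl
    ... | inj₂ u∈xs = time-input x<m u∈xs (All.lookup xs∉r)

-- The queue stays increasing with the running maximum at its back.
queueRun-sorted : ∀ xs → AllPairs _≢_ xs → QueueSortedFrom xs
queueRun-sorted [] _ k m q inv _ =
  SortedBy-constKey (increasing inv) (queueTimeFrom-queued {k} {m} {q} {[]}) , ↭-reflexive (sym (++-identityʳ q))
queueRun-sorted (x ∷ xs) (x∉xs ∷ xs-distinct) k m q inv (x∉q ∷ xs∉q) with m <? x
... | yes m<x = append m<x
  where open QueueStep {x} {xs} {k} {m} {q} (queueRun-sorted xs xs-distinct) inv x∉q x∉xs xs∉q
... | no m≮x = bool-case (belowFront x q) (bypass x<m) (pop x<m)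
  where
  open QueueStep {x} {xs} {k} {m} {q} (queueRun-sorted xs xs-distinct) inv x∉q x∉xs xs∉q
  x<m = ≮∧≢⇒> m≮x (λ { refl → x∉q (max∈ inv) })

queueSort-sorted : ∀ L → AllPairs _≢_ L → SortedBy (queueTime 0 0 L) (queueSort L) × (queueSort L ↭ L)
queueSort-sorted []       _ = [] , ↭-refl
queueSort-sorted (x ∷ xs) (x∉xs ∷ xs-distinct) =
  SortedBy-cong (proj₁ IH) (time-start ∘ ∈-resp-↭ (proj₂ IH)) , proj₂ IH
  where
  IH = queueRun-sorted xs xs-distinct 1 x [ x ] (queueInv ([] ∷ []) (here refl) (≤-refl ∷ []))
         (All.map (λ x≢u → λ { (here u≡x) → x≢u (sym u≡x) }) x∉xs)
  time-start : ∀ {u} → u ∈ x ∷ xs → queueTimeFrom 1 x [ x ] xs u ≡ queueTime 0 0 (x ∷ xs) u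
  time-start (here refl) rewrite ≡ᵇ-refl x | ≮⇒<ᵇ-false {x} {0} (λ ()) = refl
  time-start {u} (there u∈xs) rewrite ≢⇒≡ᵇ-false {u} {x} (All.lookup x∉xs u∈xs ∘ sym) | ⊔-identityˡ x = refl

Injf : ∀ {n} → (Fin n → ℕ) → Set
Injf {n} w = ∀ (a b : Fin n) → w a ≡ w b → a ≡ b

module Enumeration {n : ℕ} (w : Fin n → ℕ) (w-inj : Injf w) where

  IndexLt : ℕ → ℕ → Set
  IndexLt a b = Σ (Fin n) λ i → Σ (Fin n) λ j → w i ≡ a × w j ≡ b × toℕ i < toℕ j

  IndexLt-at : ∀ {i j} → IndexLt (w i) (w j) → toℕ i < toℕ j
  IndexLt-at {i} {j} (i′ , j′ , e₁ , e₂ , p) rewrite w-inj i′ i e₁ | w-inj j′ j e₂ = p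

  IndexLt-irrefl : ∀ {a} → ¬ IndexLt a a
  IndexLt-irrefl (i , j , refl , e , p) rewrite w-inj j i e = <-irrefl refl p

  IndexLt-asym : ∀ {a b} → IndexLt a b → ¬ IndexLt b a
  IndexLt-asym (i , j , refl , refl , p) q = <-asym p (IndexLt-at q)

  IndexLt-sorted : AllPairs IndexLt (tabulate w)
  IndexLt-sorted = APP.tabulate⁺-< (λ {i} {j} p → i , j , refl , refl , p)

  Precedes⇒index< : ∀ i j → Precedes (tabulate w) (w i) (w j) → toℕ i < toℕ j
  Precedes⇒index< i j p = IndexLt-at (Precedes⇒rel IndexLt-sorted p)

  index<⇒Precedes : ∀ i j → toℕ i < toℕ j → Precedes (tabulate w) (w i) (w j)
  index<⇒Precedes i j p = rel⇒Precedes IndexLt-irrefl IndexLt-asym IndexLt-sorted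
    (∈-tabulate⁺ i) (∈-tabulate⁺ j) (i , j , refl , refl , p)

  Precedes-iff : ∀ i j → Iff (toℕ i < toℕ j) (Precedes (tabulate w) (w i) (w j))
  Precedes-iff i j = index<⇒Precedes i j , Precedes⇒index< i j

≡-tabulate : ∀ (l : List ℕ) n → length l ≡ n → Σ (Fin n → ℕ) λ w → l ≡ tabulate w
≡-tabulate l _ refl = List.lookup l , sym (tabulate-lookup l)

oneLine≡tabulate : ∀ {n} (σ : Perm n) → oneLine σ ≡ tabulate (val σ)
oneLine≡tabulate σ = map-tabulate (λ i → i) (val σ)

Injf-val : ∀ {n} (σ : Perm n) → Injf (val σ)
Injf-val σ a b e = inj σ (toℕ-injective e)

length-oneLine : ∀ {n} (σ : Perm n) → length (oneLine σ) ≡ n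
length-oneLine σ = trans (cong length (oneLine≡tabulate σ)) (length-tabulate (val σ))

∈-oneLine : ∀ {n} (σ : Perm n) a → val σ a ∈ oneLine σ
∈-oneLine σ a = subst (val σ a ∈_) (sym (oneLine≡tabulate σ)) (∈-tabulate⁺ a)

∈-oneLine⁻ : ∀ {n} (σ : Perm n) {x} → x ∈ oneLine σ → Σ (Fin n) λ a → x ≡ val σ a
∈-oneLine⁻ σ x∈ = ∈-tabulate⁻ (subst (_ ∈_) (oneLine≡tabulate σ) x∈)

AllPairs-tabulate⁻ : ∀ {R : ℕ → ℕ → Set} {n} (g : Fin n → ℕ) → AllPairs R (tabulate g) →
  ∀ i j → toℕ i < toℕ j → R (g i) (g j)
AllPairs-tabulate⁻ g (h ∷ t) zero    (suc j) _         = All.lookup h (∈-tabulate⁺ j)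
AllPairs-tabulate⁻ g (h ∷ t) (suc i) (suc j) (s<s i<j) = AllPairs-tabulate⁻ (g ∘ suc) t i j i<j

distinct⇒Injf : ∀ {n} (w : Fin n → ℕ) → AllPairs _≢_ (tabulate w) → Injf w
distinct⇒Injf w distinct a b e with <-cmp (toℕ a) (toℕ b)
... | tri< a<b _ _ = ⊥-elim (AllPairs-tabulate⁻ w distinct a b a<b e)
... | tri≈ _ a≡b _ = toℕ-injective a≡b
... | tri> _ _ b<a = ⊥-elim (AllPairs-tabulate⁻ w distinct b a b<a (sym e))

Injf⇒distinct : ∀ {n} (w : Fin n → ℕ) → Injf w → AllPairs _≢_ (tabulate w)
Injf⇒distinct w w-inj = APP.tabulate⁺-< (λ {i} {j} i<j e → <-irrefl (cong toℕ (w-inj i j e)) i<j)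

x₀ : ∀ {k} → Fin (suc k)
x₀ = zero
x₁ : ∀ {k} → Fin (suc (suc k))
x₁ = suc zero
x₂ : ∀ {k} → Fin (suc (suc (suc k)))
x₂ = suc (suc zero)
x₃ : ∀ {k} → Fin (suc (suc (suc (suc k))))
x₃ = suc (suc (suc zero))

θ-at : Formula 2 → ∀ {k} → Fin k → Fin k → Formula k
θ-at θ x y = rename (args₂ x y) θ

timed : Formula 2 → ∀ {k} → Fin k → Formula k
timed θ x = ∃f (θ-at θ (suc x) x₀)

-- θ(u , c) is to say that u is output while the entry at position c is read;
-- entries for which there is no such c leave at the final flush.
bothTimedBefore : Formula 2 → Formula 2
bothTimedBefore θ = ∃f (∃f (θ-at θ x₂ x₁ ∧f (θ-at θ x₃ x₀ ∧f ((x₁ <P x₀) ∨f ((x₁ ≐ x₀) ∧f (x₂ <V x₃))))))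

outputBefore : Formula 2 → Formula 2
outputBefore θ =
      bothTimedBefore θ
  ∨f ((timed θ x₀ ∧f (¬f timed θ x₁))
  ∨f ((¬f timed θ x₀) ∧f ((¬f timed θ x₁) ∧f (x₀ <V x₁))))

<ₗₑₓ-by-flush : ∀ {n a b x y} → a ≤ n → b ≤ n →
  Iff ((a , x) <ₗₑₓ (b , y))
      ((a < n × b < n × (a , x) <ₗₑₓ (b , y)) ⊎ (a < n × ¬ b < n) ⊎ (¬ a < n × ¬ b < n × x < y))
<ₗₑₓ-by-flush {n} {a} {b} a≤n b≤n = to , from
  where
  to : (a , _) <ₗₑₓ (b , _) → _
  to l@(inj₁ a<b) with b <? n
  ... | yes b<n = inj₁ (<-trans a<b b<n , b<n , l)
  ... | no  b≮n = inj₂ (inj₁ (<-≤-trans a<b b≤n , b≮n))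
  to l@(inj₂ (refl , x<y)) with a <? n
  ... | yes a<n = inj₁ (a<n , a<n , l)
  ... | no  a≮n = inj₂ (inj₂ (a≮n , a≮n , x<y))
  from : _ → (a , _) <ₗₑₓ (b , _)
  from (inj₁ (_ , _ , l))               = l
  from (inj₂ (inj₁ (a<n , b≮n)))        = inj₁ (<-≤-trans a<n (≮⇒≥ b≮n))
  from (inj₂ (inj₂ (a≮n , b≮n , x<y))) =
    inj₂ (trans (≤-antisym a≤n (≮⇒≥ a≮n)) (≤-antisym (≮⇒≥ b≮n) b≤n) , x<y)

module OutputOrder {n : ℕ} (w : Fin n → ℕ) (θ : Formula 2) (t : Fin n → ℕ)
  (θ-spec : ∀ u c → Iff (evalWith posLt (valueLt w) θ (u ∷v c ∷v []v) ≡ true) (t u ≡ toℕ c))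
  (t≤n : ∀ u → t u ≤ n) where

  ev : ∀ {k} → Formula k → Vec (Fin n) k → Bool
  ev = evalWith posLt (valueLt w)

  θ-at-spec : ∀ {k} (x y : Fin k) ρ → Iff (ev (θ-at θ x y) ρ ≡ true) (t (lookup ρ x) ≡ toℕ (lookup ρ y))
  θ-at-spec x y ρ = iff-≡true (evalWith-args₂ x y θ ρ) (θ-spec _ _)

  ∃-time-iff : ∀ u → Iff (∃ λ c → t u ≡ toℕ c) (t u < n)
  ∃-time-iff u = (λ (c , e) → subst (_< n) (sym e) (toℕ<n c)) ,
                 (λ p → fromℕ< p , sym (toℕ-fromℕ< p))

  timed-spec : ∀ {k} (x : Fin k) ρ → Iff (ev (timed θ x) ρ ≡ true) (t (lookup ρ x) < n)
  timed-spec x ρ = iff-trans (any-iff (λ c → θ-at-spec (suc x) x₀ (c ∷v ρ))) (∃-time-iff _)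

  bothTimedBefore-spec : ∀ u v →
    Iff (ev (bothTimedBefore θ) (u ∷v v ∷v []v) ≡ true)
        (t u < n × t v < n × (t u , w u) <ₗₑₓ (t v , w v))
  bothTimedBefore-spec u v = iff-trans
    (any-iff λ c → any-iff λ c′ → ∧-iff (θ-at-spec x₂ x₁ _) (∧-iff (θ-at-spec x₃ x₀ _)
      (∨-iff (<ᵇ-iff {toℕ c}) (∧-iff (≡ᵇ-iff {toℕ c}) (<ᵇ-iff {w u})))))
    ((λ (c , c′ , tu , tv , l) → subst (_< n) (sym tu) (toℕ<n c) , subst (_< n) (sym tv) (toℕ<n c′) ,
                                  subst₂ (λ a b → (a , w u) <ₗₑₓ (b , w v)) (sym tu) (sym tv) l) ,
     (λ (tu<n , tv<n , l) → fromℕ< tu<n , fromℕ< tv<n , sym (toℕ-fromℕ< tu<n) , sym (toℕ-fromℕ< tv<n) ,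
                            subst₂ (λ a b → (a , w u) <ₗₑₓ (b , w v)) (sym (toℕ-fromℕ< tu<n)) (sym (toℕ-fromℕ< tv<n)) l))

  outputBefore-spec : ∀ u v → Iff (ev (outputBefore θ) (u ∷v v ∷v []v) ≡ true) ((t u , w u) <ₗₑₓ (t v , w v))
  outputBefore-spec u v = iff-trans
    (∨-iff (bothTimedBefore-spec u v)
      (∨-iff (∧-iff (timed-spec x₀ _) (not-iff (timed-spec x₁ _)))
             (∧-iff (not-iff (timed-spec x₀ _)) (∧-iff (not-iff (timed-spec x₁ _)) (<ᵇ-iff {w u})))))
    (iff-sym (<ₗₑₓ-by-flush (t≤n u) (t≤n v)))

≡+0-contra : ∀ {A : Set} {k t} → suc k ≤ t → t ≡ k + 0 → A
≡+0-contra {k = k} p e = ⊥-elim (<-irrefl refl (subst (suc k ≤_) (trans e (+-identityʳ k)) p))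

≡+suc-contra : ∀ {A : Set} k c → k ≡ k + suc c → A
≡+suc-contra k c e = ⊥-elim (m+1+n≢m k (sym e))

iff-≡ʳ : ∀ {t a b : ℕ} → a ≡ b → Iff (t ≡ a) (t ≡ b)
iff-≡ʳ refl = iff-refl

now-iff : ∀ {n} k (c : Fin (suc n)) → Iff (k ≡ k + toℕ c) (c ≡ zero)
now-iff k zero    = (λ _ → refl) , (λ _ → sym (+-identityʳ k))
now-iff k (suc c) = ≡+suc-contra k (toℕ c) , λ ()

suc-iff : ∀ {n} {c i : Fin n} → Iff (c ≡ i) (Fin.suc c ≡ suc i)
suc-iff = cong suc , Finₚ.suc-injective

Injf-suc : ∀ {n} (w : Fin (suc n) → ℕ) → Injf w → Injf (w ∘ suc)
Injf-suc w w-inj a b e = Finₚ.suc-injective (w-inj (suc a) (suc b) e)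

Injf-suc≢zero : ∀ {n} (w : Fin (suc n) → ℕ) → Injf w → ∀ i → w (suc i) ≢ w zero
Injf-suc≢zero w w-inj i e with w-inj (suc i) zero e
... | ()

FirstAt : ∀ {n} → (Fin n → Set) → Fin n → Set
FirstAt P c = P c × (∀ d → toℕ d < toℕ c → ¬ P d)

FirstAt-cong : ∀ {n} {P Q : Fin n → Set} {c} → (∀ d → Iff (P d) (Q d)) → Iff (FirstAt P c) (FirstAt Q c)
FirstAt-cong h = (λ (p , f) → proj₁ (h _) p , λ d d<c q → f d d<c (proj₂ (h d) q)) ,
                 (λ (q , f) → proj₂ (h _) q , λ d d<c p → f d d<c (proj₁ (h d) p))

FirstAt-suc : ∀ {n} {P : Fin (suc n) → Set} {c} → ¬ P zero → Iff (FirstAt (P ∘ suc) c) (FirstAt P (suc c))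
FirstAt-suc ¬P₀ = (λ (p , f) → p , λ { zero _ → ¬P₀ ; (suc d) (s<s d<c) → f d d<c }) ,
                  (λ (p , f) → p , λ d d<c → f (suc d) (s<s d<c))

Cases : Set → Set → Set → Set
Cases A Y Z = (A × Y) ⊎ (¬ A × Z)

Cases-yes : ∀ {A Y Z : Set} → A → Iff Y (Cases A Y Z)
Cases-yes a = (λ y → inj₁ (a , y)) , (λ { (inj₁ (_ , y)) → y ; (inj₂ (¬a , _)) → ⊥-elim (¬a a) })

Cases-no : ∀ {A Y Z : Set} → ¬ A → Iff Z (Cases A Y Z)
Cases-no ¬a = (λ z → inj₂ (¬a , z)) , (λ { (inj₁ (a , _)) → ⊥-elim (¬a a) ; (inj₂ (_ , z)) → z })

Cases-iff : ∀ {A A′ Y Y′ Z Z′ : Set} → Iff A A′ → Iff Y Y′ → Iff Z Z′ → Iff (Cases A Y Z) (Cases A′ Y′ Z′)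
Cases-iff a y z = ⊎-iff (×-iff a y) (×-iff (¬-iff a) z)

NotLRMax : ∀ {n} → ℕ → (Fin n → ℕ) → Fin n → Set
NotLRMax {n} m w i = w i < m ⊎ Σ (Fin n) λ d → toℕ d < toℕ i × w i < w d

NotLRMax-zero : ∀ {n} m (w : Fin (suc n) → ℕ) → Iff (NotLRMax m w zero) (w zero < m)
NotLRMax-zero m w = (λ { (inj₁ p) → p ; (inj₂ (d , () , _)) }) , inj₁

NotLRMax-suc : ∀ {n} m (w : Fin (suc n) → ℕ) i → Iff (NotLRMax (m ⊔ w zero) (w ∘ suc) i) (NotLRMax m w (suc i))
NotLRMax-suc m w i = to , from
  where
  to : NotLRMax (m ⊔ w zero) (w ∘ suc) i → NotLRMax m w (suc i)
  to (inj₁ p) with <-⊔⁻ {m} {w zero} p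
  ... | inj₁ p<m  = inj₁ p<m
  ... | inj₂ p<w₀ = inj₂ (zero , z<s , p<w₀)
  to (inj₂ (d , d<i , p)) = inj₂ (suc d , s<s d<i , p)
  from : NotLRMax m w (suc i) → NotLRMax (m ⊔ w zero) (w ∘ suc) i
  from (inj₁ p)                  = inj₁ (<-≤-trans p (m≤m⊔n m (w zero)))
  from (inj₂ (zero , _ , p))     = inj₁ (<-≤-trans p (m≤n⊔m m (w zero)))
  from (inj₂ (suc d , s<s d<i , p)) = inj₂ (d , d<i , p)

-- StackOut w i c: stack sorting w outputs its entry at i while the one at c is read;
-- likewise BubbleOut and QueueOut, m being the maximum of the entries read before w.
StackOut : ∀ {n} → (Fin n → ℕ) → Fin n → Fin n → Set
StackOut w i = FirstAt (λ d → toℕ i < toℕ d × w i < w d)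

BubbleOut : ∀ {n} → ℕ → (Fin n → ℕ) → Fin n → Fin n → Set
BubbleOut m w i c = Cases (NotLRMax m w i) (c ≡ i) (StackOut w i c)

Pops : ∀ {n} → ℕ → ℕ → (Fin n → ℕ) → Fin n → Set
Pops u m w d = u < w d × NotLRMax m w d

QueueOut : ∀ {n} → ℕ → (Fin n → ℕ) → Fin n → Fin n → Set
QueueOut m w i c = Cases (NotLRMax m w i) (c ≡ i) (FirstAt (λ d → toℕ i < toℕ d × Pops (w i) m w d) c)

firstIndexFrom-spec : ∀ {n} (v : Fin n → ℕ) p k c →
  Iff (firstIndexFrom k p (tabulate v) ≡ k + toℕ c) (FirstAt (λ d → p (v d) ≡ true) c)
firstIndexFrom-spec {suc n} v p k c with p (v zero) in e
firstIndexFrom-spec v p k zero     | true  = (λ _ → e , λ _ ()) , (λ _ → sym (+-identityʳ k))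
firstIndexFrom-spec v p k (suc c)  | true  = ≡+suc-contra k (toℕ c) , (λ (_ , f) → ⊥-elim (f zero z<s e))
firstIndexFrom-spec v p k zero     | false =
  ≡+0-contra (firstIndexFrom-≥ (suc k) p (tabulate (v ∘ suc))) , (λ (q , _) → ⊥-elim (false⇒¬true e q))
firstIndexFrom-spec v p k (suc c)  | false =
  iff-trans (iff-≡ʳ (+-suc k (toℕ c)))
    (iff-trans (firstIndexFrom-spec (v ∘ suc) p (suc k) c) (FirstAt-suc (false⇒¬true e)))

Pops-zero : ∀ {n} u m (v : Fin (suc n) → ℕ) → Iff (((u <ᵇ v zero) ∧ (v zero <ᵇ m)) ≡ true) (Pops u m v zero)
Pops-zero u m v = ∧-iff <ᵇ-iff (iff-trans <ᵇ-iff (iff-sym (NotLRMax-zero m v)))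

queuedTime-spec : ∀ {n} (v : Fin n → ℕ) u m k c →
  Iff (queuedTime k m u (tabulate v) ≡ k + toℕ c) (FirstAt (Pops u m v) c)
queuedTime-spec {suc n} v u m k c with (u <ᵇ v zero) ∧ (v zero <ᵇ m) in e
queuedTime-spec v u m k zero    | true  = (λ _ → proj₁ (Pops-zero u m v) e , λ _ ()) , (λ _ → sym (+-identityʳ k))
queuedTime-spec v u m k (suc c) | true  =
  ≡+suc-contra k (toℕ c) , (λ (_ , f) → ⊥-elim (f zero z<s (proj₁ (Pops-zero u m v) e)))
queuedTime-spec v u m k zero    | false =
  ≡+0-contra (queuedTime-≥ (suc k) (m ⊔ v zero) u (tabulate (v ∘ suc))) ,
  (λ (p , _) → ⊥-elim (false⇒¬true e (proj₂ (Pops-zero u m v) p)))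
queuedTime-spec v u m k (suc c) | false =
  iff-trans (iff-≡ʳ (+-suc k (toℕ c))) (iff-trans (queuedTime-spec (v ∘ suc) u (m ⊔ v zero) (suc k) c)
    (iff-trans (FirstAt-cong (λ d → ×-iff iff-refl (NotLRMax-suc m v d)))
               (FirstAt-suc (false⇒¬true e ∘ proj₂ (Pops-zero u m v)))))

StackOut-suc : ∀ {n} (w : Fin (suc n) → ℕ) i c → Iff (StackOut (w ∘ suc) i c) (StackOut w (suc i) (suc c))
StackOut-suc w i c = iff-trans (FirstAt-cong (λ d → ×-iff (s<s , s<s⁻¹) iff-refl)) (FirstAt-suc (λ { (() , _) }))

firstLarger-spec : ∀ {n} (w : Fin (suc n) → ℕ) k c →
  Iff (firstIndexFrom (suc k) (w zero <ᵇ_) (tabulate (w ∘ suc)) ≡ k + toℕ c) (StackOut w zero c)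
firstLarger-spec w k zero    =
  ≡+0-contra (firstIndexFrom-≥ (suc k) (w zero <ᵇ_) (tabulate (w ∘ suc))) , (λ { ((() , _) , _) })
firstLarger-spec w k (suc c) =
  iff-trans (iff-≡ʳ (+-suc k (toℕ c))) (iff-trans (firstIndexFrom-spec (w ∘ suc) (w zero <ᵇ_) (suc k) c)
    (iff-trans (FirstAt-cong (λ d → iff-trans <ᵇ-iff ((λ p → z<s , p) , proj₂))) (FirstAt-suc (λ { (() , _) }))))

stackTime-spec : ∀ {n} (w : Fin n → ℕ) → Injf w → ∀ k i c →
  Iff (stackTime k (tabulate w) (w i) ≡ k + toℕ c) (StackOut w i c)
stackTime-spec {suc n} w w-inj k zero c rewrite stackTime-head k (w zero) (tabulate (w ∘ suc)) =
  firstLarger-spec w k c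
stackTime-spec {suc n} w w-inj k (suc i) c
  rewrite stackTime-tail k (w zero) (tabulate (w ∘ suc)) (w (suc i)) (Injf-suc≢zero w w-inj i) = later c
  where
  later : ∀ c → Iff (stackTime (suc k) (tabulate (w ∘ suc)) (w (suc i)) ≡ k + toℕ c) (StackOut w (suc i) c)
  later zero    = ≡+0-contra (stackTime-≥ (suc k) (tabulate (w ∘ suc)) (w (suc i))) , (λ { ((() , _) , _) })
  later (suc c) = iff-trans (iff-≡ʳ (+-suc k (toℕ c)))
    (iff-trans (stackTime-spec (w ∘ suc) (Injf-suc w w-inj) (suc k) i c) (StackOut-suc w i c))

bubbleTime-head : ∀ k m x xs → bubbleTime k m (x ∷ xs) x ≡ (if x <ᵇ m then k else firstIndexFrom (suc k) (x <ᵇ_) xs)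
bubbleTime-head k m x xs rewrite ≡ᵇ-refl x = refl

bubbleTime-tail : ∀ k m x xs u → u ≢ x → bubbleTime k m (x ∷ xs) u ≡ bubbleTime (suc k) (m ⊔ x) xs u
bubbleTime-tail k m x xs u u≢x rewrite ≢⇒≡ᵇ-false u≢x = refl

bubbleTime-spec : ∀ {n} (w : Fin n → ℕ) → Injf w → ∀ k m i c →
  Iff (bubbleTime k m (tabulate w) (w i) ≡ k + toℕ c) (BubbleOut m w i c)
bubbleTime-spec {suc n} w w-inj k m zero c rewrite bubbleTime-head k m (w zero) (tabulate (w ∘ suc))
  with w zero <? m
... | yes w₀<m rewrite <⇒<ᵇ-true w₀<m = iff-trans (now-iff k c) (Cases-yes (inj₁ w₀<m))
... | no  w₀≮m rewrite ≮⇒<ᵇ-false w₀≮m =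
  iff-trans (firstLarger-spec w k c) (Cases-no (w₀≮m ∘ proj₁ (NotLRMax-zero m w)))
bubbleTime-spec {suc n} w w-inj k m (suc i) c
  rewrite bubbleTime-tail k m (w zero) (tabulate (w ∘ suc)) (w (suc i)) (Injf-suc≢zero w w-inj i) = later c
  where
  later : ∀ c → Iff (bubbleTime (suc k) (m ⊔ w zero) (tabulate (w ∘ suc)) (w (suc i)) ≡ k + toℕ c) (BubbleOut m w (suc i) c)
  later zero    = ≡+0-contra (bubbleTime-≥ (suc k) (m ⊔ w zero) (tabulate (w ∘ suc)) (w (suc i))) ,
                  (λ { (inj₁ (_ , ())) ; (inj₂ (_ , (() , _) , _)) })
  later (suc c) = iff-trans (iff-≡ʳ (+-suc k (toℕ c)))
    (iff-trans (bubbleTime-spec (w ∘ suc) (Injf-suc w w-inj) (suc k) (m ⊔ w zero) i c)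
               (Cases-iff (NotLRMax-suc m w i) suc-iff (StackOut-suc w i c)))

queueTime-head : ∀ k m x xs → queueTime k m (x ∷ xs) x ≡ (if x <ᵇ m then k else queuedTime (suc k) x x xs)
queueTime-head k m x xs rewrite ≡ᵇ-refl x = refl

queueTime-tail : ∀ k m x xs u → u ≢ x → queueTime k m (x ∷ xs) u ≡ queueTime (suc k) (m ⊔ x) xs u
queueTime-tail k m x xs u u≢x rewrite ≢⇒≡ᵇ-false u≢x = refl

QueuePop-suc : ∀ {n} m (w : Fin (suc n) → ℕ) i c →
  Iff (FirstAt (λ d → toℕ i < toℕ d × Pops (w (suc i)) (m ⊔ w zero) (w ∘ suc) d) c)
      (FirstAt (λ d → toℕ (Fin.suc i) < toℕ d × Pops (w (suc i)) m w d) (suc c))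
QueuePop-suc m w i c =
  iff-trans (FirstAt-cong (λ d → ×-iff (s<s , s<s⁻¹) (×-iff iff-refl (NotLRMax-suc m w d)))) (FirstAt-suc (λ { (() , _) }))

firstPop-spec : ∀ {n} (w : Fin (suc n) → ℕ) k m → ¬ w zero < m → ∀ c →
  Iff (queuedTime (suc k) (w zero) (w zero) (tabulate (w ∘ suc)) ≡ k + toℕ c)
      (FirstAt (λ d → toℕ (Fin.zero {n}) < toℕ d × Pops (w zero) m w d) c)
firstPop-spec w k m w₀≮m zero    =
  ≡+0-contra (queuedTime-≥ (suc k) (w zero) (w zero) (tabulate (w ∘ suc))) , (λ { ((() , _) , _) })
firstPop-spec w k m w₀≮m (suc c) =
  iff-trans (iff-≡ʳ (+-suc k (toℕ c))) (iff-trans (queuedTime-spec (w ∘ suc) (w zero) (w zero) (suc k) c)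
    (iff-trans (FirstAt-cong (λ d → iff-trans (subst (λ m′ → Iff (Pops (w zero) m′ (w ∘ suc) d) (Pops (w zero) m w (suc d)))
                                                     (≮⇒⊔≡ʳ w₀≮m)
                                                     (×-iff iff-refl (NotLRMax-suc m w d)))
                                            ((λ p → z<s , p) , proj₂)))
               (FirstAt-suc (λ { (() , _) }))))

queueTime-spec : ∀ {n} (w : Fin n → ℕ) → Injf w → ∀ k m i c →
  Iff (queueTime k m (tabulate w) (w i) ≡ k + toℕ c) (QueueOut m w i c)
queueTime-spec {suc n} w w-inj k m zero c rewrite queueTime-head k m (w zero) (tabulate (w ∘ suc))
  with w zero <? m
... | yes w₀<m rewrite <⇒<ᵇ-true w₀<m = iff-trans (now-iff k c) (Cases-yes (inj₁ w₀<m))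
... | no  w₀≮m rewrite ≮⇒<ᵇ-false w₀≮m =
  iff-trans (firstPop-spec w k m w₀≮m c) (Cases-no (w₀≮m ∘ proj₁ (NotLRMax-zero m w)))
queueTime-spec {suc n} w w-inj k m (suc i) c
  rewrite queueTime-tail k m (w zero) (tabulate (w ∘ suc)) (w (suc i)) (Injf-suc≢zero w w-inj i) = later c
  where
  later : ∀ c → Iff (queueTime (suc k) (m ⊔ w zero) (tabulate (w ∘ suc)) (w (suc i)) ≡ k + toℕ c) (QueueOut m w (suc i) c)
  later zero    = ≡+0-contra (queueTime-≥ (suc k) (m ⊔ w zero) (tabulate (w ∘ suc)) (w (suc i))) ,
                  (λ { (inj₁ (_ , ())) ; (inj₂ (_ , (() , _) , _)) })
  later (suc c) = iff-trans (iff-≡ʳ (+-suc k (toℕ c)))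
    (iff-trans (queueTime-spec (w ∘ suc) (Injf-suc w w-inj) (suc k) (m ⊔ w zero) i c)
               (Cases-iff (NotLRMax-suc m w i) suc-iff (QueuePop-suc m w i c)))

_⇒f_ : ∀ {k} → Formula k → Formula k → Formula k
φ ⇒f ψ = (¬f φ) ∨f ψ

⇒-iff : ∀ {a b X Y} → Iff (a ≡ true) X → Iff (b ≡ true) Y → Iff ((not a ∨ b) ≡ true) (X → Y)
⇒-iff {a} ha hb = to , from
  where
  to : _ → _
  to e x with ∨-true⁻ {not a} e
  ... | inj₁ ¬a = ⊥-elim (not-true⁻ ¬a (proj₂ ha x))
  ... | inj₂ b  = proj₁ hb b
  from : _ → _
  from f = bool-case a (λ a≡true → ∨-trueʳ {not a} (proj₂ hb (f (proj₁ ha a≡true))))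
                       (λ { refl → refl })

_⇔f_ : ∀ {k} → Formula k → Formula k → Formula k
φ ⇔f ψ = (φ ⇒f ψ) ∧f (ψ ⇒f φ)

⇔-iff : ∀ {a b X Y} → Iff (a ≡ true) X → Iff (b ≡ true) Y → Iff (((not a ∨ b) ∧ (not b ∨ a)) ≡ true) (Iff X Y)
⇔-iff ha hb = ∧-iff (⇒-iff ha hb) (⇒-iff hb ha)

-- firstAt φ holds of (i , c) when c is the first position d satisfying φ(d , i).
firstAt : Formula 2 → Formula 2
firstAt φ = rename (args₂ x₁ x₀) φ ∧f ∀f ((x₀ <P x₂) ⇒f (¬f rename (args₂ x₀ x₁) φ))

notLRMax : ∀ {k} → Fin k → Formula k
notLRMax x = ∃f ((x₀ <P suc x) ∧f (suc x <V x₀))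

θS θB θQ : Formula 2
θS = firstAt ((x₁ <P x₀) ∧f (x₁ <V x₀))
θB = (notLRMax x₀ ∧f (x₁ ≐ x₀)) ∨f ((¬f notLRMax x₀) ∧f θS)
θQ = (notLRMax x₀ ∧f (x₁ ≐ x₀)) ∨f ((¬f notLRMax x₀) ∧f firstAt ((x₁ <P x₀) ∧f ((x₁ <V x₀) ∧f notLRMax x₀)))

module TimeFormulas {n : ℕ} (w : Fin n → ℕ) where

  ev : ∀ {k} → Formula k → Vec (Fin n) k → Bool
  ev = evalWith posLt (valueLt w)

  firstAt-spec : ∀ φ {P : Fin n → Fin n → Set} → (∀ d i → Iff (ev φ (d ∷v i ∷v []v) ≡ true) (P i d)) →
    ∀ i c → Iff (ev (firstAt φ) (i ∷v c ∷v []v) ≡ true) (FirstAt (P i) c)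
  firstAt-spec φ φ-spec i c = ∧-iff (iff-≡true (evalWith-args₂ x₁ x₀ φ _) (φ-spec c i))
    (all-iff λ d → ⇒-iff <ᵇ-iff (not-iff (iff-≡true (evalWith-args₂ x₀ x₁ φ _) (φ-spec d i))))

  notLRMax-spec : ∀ {k} (x : Fin k) ρ → Iff (ev (notLRMax x) ρ ≡ true) (NotLRMax 0 w (lookup ρ x))
  notLRMax-spec x ρ = iff-trans (any-iff (λ d → ∧-iff <ᵇ-iff <ᵇ-iff)) (inj₂ , λ { (inj₁ ()) ; (inj₂ p) → p })

  ≐-spec : ∀ i c → Iff (ev (x₁ ≐ x₀) (i ∷v c ∷v []v) ≡ true) (c ≡ i)
  ≐-spec i c = iff-trans ≡ᵇ-iff (toℕ-injective , cong toℕ)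

  θS-spec : ∀ i c → Iff (ev θS (i ∷v c ∷v []v) ≡ true) (StackOut w i c)
  θS-spec = firstAt-spec ((x₁ <P x₀) ∧f (x₁ <V x₀)) (λ d i → ∧-iff <ᵇ-iff <ᵇ-iff)

  θB-spec : ∀ i c → Iff (ev θB (i ∷v c ∷v []v) ≡ true) (BubbleOut 0 w i c)
  θB-spec i c = ∨-iff (∧-iff (notLRMax-spec x₀ (i ∷v c ∷v []v)) (≐-spec i c))
                      (∧-iff (not-iff (notLRMax-spec x₀ (i ∷v c ∷v []v))) (θS-spec i c))

  θQ-spec : ∀ i c → Iff (ev θQ (i ∷v c ∷v []v) ≡ true) (QueueOut 0 w i c)
  θQ-spec i c = ∨-iff (∧-iff (notLRMax-spec x₀ (i ∷v c ∷v []v)) (≐-spec i c))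
    (∧-iff (not-iff (notLRMax-spec x₀ (i ∷v c ∷v []v)))
           (firstAt-spec ((x₁ <P x₀) ∧f ((x₁ <V x₀) ∧f notLRMax x₀))
                         (λ d i → ∧-iff <ᵇ-iff (∧-iff <ᵇ-iff (notLRMax-spec x₀ (d ∷v i ∷v []v)))) i c))

module Definability (O : List ℕ → List ℕ) (T : List ℕ → ℕ → ℕ) (θ : Formula 2)
  (O-sorted : ∀ L → AllPairs _≢_ L → SortedBy (T L) (O L) × (O L ↭ L))
  (T-≤ : ∀ L u → T L u ≤ length L)
  (θ-spec : ∀ {n} (w : Fin n → ℕ) → Injf w → ∀ i c →
    Iff (evalWith posLt (valueLt w) θ (i ∷v c ∷v []v) ≡ true) (T (tabulate w) (w i) ≡ toℕ c)) where

  O-↭ : ∀ L → AllPairs _≢_ L → O L ↭ L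
  O-↭ L distinct = proj₂ (O-sorted L distinct)

  O-distinct : ∀ L → AllPairs _≢_ L → AllPairs _≢_ (O L)
  O-distinct L distinct = SortedBy-distinct (proj₁ (O-sorted L distinct))

  outputBefore-Precedes : ∀ {n} (w : Fin n → ℕ) → Injf w → ∀ i j →
    Iff (evalWith posLt (valueLt w) (outputBefore θ) (i ∷v j ∷v []v) ≡ true) (Precedes (O (tabulate w)) (w i) (w j))
  outputBefore-Precedes {n} w w-inj i j =
    iff-trans (outputBefore-spec i j) (SortedBy-Precedes⁺ {T L} sorted (∈O i) (∈O j) , Precedes⇒rel {KeyLt (T L)} sorted)
    where
    L = tabulate w
    sorted = proj₁ (O-sorted L (Injf⇒distinct w w-inj))
    ∈O : ∀ i → w i ∈ O L
    ∈O i = ∈-resp-↭ (↭-sym (O-↭ L (Injf⇒distinct w w-inj))) (∈-tabulate⁺ i)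
    open OutputOrder w θ (T L ∘ w) (θ-spec w w-inj) (λ u → subst (T L (w u) ≤_) (length-tabulate w) (T-≤ L (w u)))

θS-time : ∀ {n} (w : Fin n → ℕ) → Injf w → ∀ i c →
  Iff (evalWith posLt (valueLt w) θS (i ∷v c ∷v []v) ≡ true) (stackTime 0 (tabulate w) (w i) ≡ toℕ c)
θS-time w w-inj i c = iff-trans (TimeFormulas.θS-spec w i c) (iff-sym (stackTime-spec w w-inj 0 i c))

θB-time : ∀ {n} (w : Fin n → ℕ) → Injf w → ∀ i c →
  Iff (evalWith posLt (valueLt w) θB (i ∷v c ∷v []v) ≡ true) (bubbleTime 0 0 (tabulate w) (w i) ≡ toℕ c)
θB-time w w-inj i c = iff-trans (TimeFormulas.θB-spec w i c) (iff-sym (bubbleTime-spec w w-inj 0 0 i c))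

θQ-time : ∀ {n} (w : Fin n → ℕ) → Injf w → ∀ i c →
  Iff (evalWith posLt (valueLt w) θQ (i ∷v c ∷v []v) ≡ true) (queueTime 0 0 (tabulate w) (w i) ≡ toℕ c)
θQ-time w w-inj i c = iff-trans (TimeFormulas.θQ-spec w i c) (iff-sym (queueTime-spec w w-inj 0 0 i c))

module StackDefinability  = Definability stackSort  (stackTime 0)    θS stackSort-sorted  (stackTime-≤ 0)    θS-time
module BubbleDefinability = Definability bubbleSort (bubbleTime 0 0) θB bubbleSort-sorted (bubbleTime-≤ 0 0) θB-time
module QueueDefinability  = Definability queueSort  (queueTime 0 0)  θQ queueSort-sorted  (queueTime-≤ 0 0)  θQ-time

opFormula : Op → Formula 2
opFormula S = outputBefore θS
opFormula B = outputBefore θB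
opFormula Q = outputBefore θQ

apply-Precedes : ∀ o {n} (w : Fin n → ℕ) → Injf w → ∀ i j →
  Iff (evalWith posLt (valueLt w) (opFormula o) (i ∷v j ∷v []v) ≡ true) (Precedes (apply o (tabulate w)) (w i) (w j))
apply-Precedes S = StackDefinability.outputBefore-Precedes
apply-Precedes B = BubbleDefinability.outputBefore-Precedes
apply-Precedes Q = QueueDefinability.outputBefore-Precedes

apply-↭ : ∀ o L → AllPairs _≢_ L → apply o L ↭ L
apply-↭ S = StackDefinability.O-↭
apply-↭ B = BubbleDefinability.O-↭
apply-↭ Q = QueueDefinability.O-↭

apply-distinct : ∀ o L → AllPairs _≢_ L → AllPairs _≢_ (apply o L)
apply-distinct S = StackDefinability.O-distinct
apply-distinct B = BubbleDefinability.O-distinct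
apply-distinct Q = QueueDefinability.O-distinct

iff⇒⇔ : ∀ {X Y : Set} → Iff X Y → X ⇔ Y
iff⇒⇔ (f , g) = mk⇔ f g

opDefinable : ∀ o → OpDefinable (apply o)
opDefinable o = opFormula o , λ n σ a b →
  iff⇒⇔ (iff-≡true (eval≡evalWith σ (opFormula o) _)
    (iff-trans (apply-Precedes o (val σ) (Injf-val σ) a b)
               (Precedes-≡ (cong (apply o) (sym (oneLine≡tabulate σ))) refl refl)))

DefinesOrder : ∀ {n} → Perm n → Formula 2 → List ℕ → Set
DefinesOrder {n} σ φ L = ∀ (a b : Fin n) →
  Iff (evalWith posLt (valueLt (val σ)) φ (a ∷v b ∷v []v) ≡ true) (Precedes L (val σ a) (val σ b))

-- Reading positions in L, the order of L becomes the position order, so applying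
-- an operator to L is applying it to a permutation isomorphic to σ.
module CompositionStep {n} (σ : Perm n) (L : List ℕ) (L↭ : L ↭ oneLine σ) (L-distinct : AllPairs _≢_ L)
  (φ : Formula 2) (φ-order : DefinesOrder σ φ L) where

  enumeration = ≡-tabulate L n (trans (↭-length L↭) (length-oneLine σ))
  w = proj₁ enumeration
  L≡ = proj₂ enumeration

  w-inj : Injf w
  w-inj = distinct⇒Injf w (subst (AllPairs _≢_) L≡ L-distinct)

  index : ∀ a → Σ (Fin n) λ i → val σ a ≡ w i
  index a = ∈-tabulate⁻ (subst (val σ a ∈_) L≡ (∈-resp-↭ (↭-sym L↭) (∈-oneLine σ a)))

  f : Fin n → Fin n
  f = proj₁ ∘ index

  w∘f : ∀ a → w (f a) ≡ val σ a
  w∘f = sym ∘ proj₂ ∘ index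

  f-inj : ∀ a b → f a ≡ f b → a ≡ b
  f-inj a b e = Injf-val σ a b (trans (sym (w∘f a)) (trans (cong w e) (w∘f b)))

  f-surj : ∀ i → Σ (Fin n) λ a → f a ≡ i
  f-surj i with ∈-oneLine⁻ σ (∈-resp-↭ L↭ (subst (w i ∈_) (sym L≡) (∈-tabulate⁺ i)))
  ... | a , wi≡va = a , w-inj (f a) i (trans (w∘f a) (sym wi≡va))

  Precedes-f : ∀ {l} a b → Iff (Precedes l (w (f a)) (w (f b))) (Precedes l (val σ a) (val σ b))
  Precedes-f a b = Precedes-≡ refl (w∘f a) (w∘f b)

  inL : Fin n → Fin n → Bool
  inL a b = evalWith posLt (valueLt (val σ)) φ (a ∷v b ∷v []v)

  f-pos : ∀ a b → posLt (f a) (f b) ≡ inL a b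
  f-pos a b = bool-ext
    (λ e → proj₂ (φ-order a b) (proj₁ (Precedes-f a b) (proj₂ (Precedes-≡ L≡ refl refl)
             (Enumeration.index<⇒Precedes w w-inj (f a) (f b) (<ᵇ-true⇒< e)))))
    (λ e → <⇒<ᵇ-true (Enumeration.Precedes⇒index< w w-inj (f a) (f b)
             (proj₁ (Precedes-≡ L≡ refl refl) (proj₂ (Precedes-f a b) (proj₁ (φ-order a b) e)))))

  f-val : ∀ a b → (w (f a) <ᵇ w (f b)) ≡ valueLt (val σ) a b
  f-val a b = cong₂ _<ᵇ_ (w∘f a) (w∘f b)

  open Isomorphism inL (valueLt (val σ)) posLt (valueLt w) f f-pos f-val f-inj f-surj

  apply-order : ∀ o → DefinesOrder σ (substPos φ (opFormula o)) (apply o L)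
  apply-order o a b =
    iff-≡true (trans (evalWith-substPos posLt (valueLt (val σ)) φ (opFormula o) (a ∷v b ∷v []v))
                     (sym (evalWith-iso (opFormula o) (a ∷v b ∷v []v))))
      (iff-trans (apply-Precedes o w w-inj (f a) (f b))
        (iff-trans (Precedes-≡ (cong (apply o) (sym L≡)) refl refl) (Precedes-f a b)))

composeFormula : List Op → Formula 2
composeFormula []       = x₀ <P x₁
composeFormula (o ∷ os) = substPos (composeFormula os) (opFormula o)

compose-spec : ∀ F {n} (σ : Perm n) →
  (compose F (oneLine σ) ↭ oneLine σ) × AllPairs _≢_ (compose F (oneLine σ)) ×
  DefinesOrder σ (composeFormula F) (compose F (oneLine σ))
compose-spec [] σ =
  ↭-refl , subst (AllPairs _≢_) (sym (oneLine≡tabulate σ)) (Injf⇒distinct (val σ) (Injf-val σ)) ,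
  λ a b → iff-trans <ᵇ-iff (iff-trans (Enumeration.Precedes-iff (val σ) (Injf-val σ) a b)
                                      (Precedes-≡ (sym (oneLine≡tabulate σ)) refl refl))
compose-spec (o ∷ os) σ with compose-spec os σ
... | L↭ , L-distinct , L-order =
  ↭-trans (apply-↭ o L (L-distinct)) L↭ , apply-distinct o L L-distinct ,
  CompositionStep.apply-order σ L L↭ L-distinct (composeFormula os) L-order o
  where L = compose os (oneLine σ)

module IncreasingBounded {n : ℕ} (g : Fin n → ℕ) (g-increasing : ∀ i j → toℕ i < toℕ j → g i < g j)
  (g-bounded : ∀ i → g i < n) where

  ≥toℕ : ∀ m (i : Fin n) → toℕ i ≡ m → m ≤ g i
  ≥toℕ zero    i e = z≤n
  ≥toℕ (suc m) i e =
    ≤-<-trans (≥toℕ m i′ (toℕ-fromℕ< m<n)) (g-increasing i′ i (subst₂ _<_ (sym (toℕ-fromℕ< m<n)) (sym e) (n<1+n m)))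
    where
    m<n = <-trans (n<1+n m) (subst (_< n) e (toℕ<n i))
    i′ = fromℕ< m<n

  -- the suc m values of g from position i on are increasing and below n
  room : ∀ m (i : Fin n) → toℕ i + suc m ≡ n → g i + suc m ≤ n
  room zero    i e = subst (_≤ n) (+-comm 1 (g i)) (g-bounded i)
  room (suc m) i e =
    ≤-trans (subst (_≤ g i′ + suc m) (sym (+-suc (g i) (suc m))) (+-monoˡ-≤ (suc m) (g-increasing i i′ i<i′)))
            (room m i′ (trans (cong (_+ suc m) (toℕ-fromℕ< 1+i<n)) (trans (sym (+-suc (toℕ i) (suc m))) e)))
    where
    1+i<n = subst (suc (toℕ i) <_) (trans (sym (+-suc (toℕ i) (suc m))) e) (s<s (m<m+n (toℕ i) z<s))
    i′ = fromℕ< 1+i<n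
    i<i′ = subst (toℕ i <_) (sym (toℕ-fromℕ< 1+i<n)) (n<1+n (toℕ i))

  ≡toℕ : ∀ i → g i ≡ toℕ i
  ≡toℕ i = ≤-antisym (+-cancelʳ-≤ (suc m) (g i) (toℕ i) (subst (g i + suc m ≤_) (sym e) (room m i e)))
                     (≥toℕ (toℕ i) i refl)
    where
    m = n ∸ suc (toℕ i)
    e = trans (+-suc (toℕ i) m) (m+[n∸m]≡n (toℕ<n i))

tabulate-toℕ : ∀ n → tabulate (toℕ {n}) ≡ upTo n
tabulate-toℕ zero    = refl
tabulate-toℕ (suc n) =
  cong (0 ∷_) (trans (sym (map-tabulate toℕ suc)) (trans (cong (map suc) (tabulate-toℕ n)) (map-upTo suc n)))

preimageFormula : List Op → Formula 0
preimageFormula F = ∃f (x₀ ≐ x₀) ∧f ∀f (∀f (rename (args₂ x₁ x₀) (composeFormula F) ⇔f (x₁ <V x₀)))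

module Preimage (F : List Op) {n : ℕ} (σ : Perm n) where

  L = compose F (oneLine σ)
  L↭ = proj₁ (compose-spec F σ)
  L-order = proj₂ (proj₂ (compose-spec F σ))

  ev : ∀ {k} → Formula k → Vec (Fin n) k → Bool
  ev = evalWith posLt (valueLt (val σ))

  Increasing : Set
  Increasing = ∀ a b → Iff (ev (composeFormula F) (a ∷v b ∷v []v) ≡ true) (val σ a < val σ b)

  enumeration = ≡-tabulate L n (trans (↭-length L↭) (length-oneLine σ))
  w = proj₁ enumeration
  L≡ = proj₂ enumeration

  entry : ∀ i → Σ (Fin n) λ a → w i ≡ val σ a
  entry i = ∈-oneLine⁻ σ (∈-resp-↭ L↭ (subst (w i ∈_) (sym L≡) (∈-tabulate⁺ i)))

  Increasing⇒≡upTo : Increasing → L ≡ upTo n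
  Increasing⇒≡upTo inc = trans L≡ (trans (tabulate-cong ≡toℕ) (tabulate-toℕ n))
    where
    w-inj = distinct⇒Injf w (subst (AllPairs _≢_) L≡ (proj₁ (proj₂ (compose-spec F σ))))
    w-increasing : ∀ i j → toℕ i < toℕ j → w i < w j
    w-increasing i j i<j with entry i | entry j
    ... | a , wi≡ | b , wj≡ = subst₂ _<_ (sym wi≡) (sym wj≡) (proj₁ (inc a b) (proj₂ (L-order a b)
      (proj₁ (Precedes-≡ (sym L≡) wi≡ wj≡) (Enumeration.index<⇒Precedes w w-inj i j i<j))))
    w-bounded : ∀ i → w i < n
    w-bounded i with entry i
    ... | a , wi≡ = subst (_< n) (sym wi≡) (toℕ<n (fun σ a))
    open IncreasingBounded w w-increasing w-bounded using (≡toℕ)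

  ≡upTo⇒Increasing : L ≡ upTo n → Increasing
  ≡upTo⇒Increasing L≡upTo a b = iff-trans (L-order a b)
    (iff-trans (Precedes-≡ (trans L≡upTo (sym (tabulate-toℕ n))) refl refl)
      (iff-sym (Enumeration.Precedes-iff toℕ (λ _ _ → toℕ-injective) (fun σ a) (fun σ b))))

  nonempty-spec : Iff (ev (∃f (x₀ ≐ x₀)) []v ≡ true) (1 ≤ n)
  nonempty-spec = iff-trans (any-iff (λ a → ≡ᵇ-iff {toℕ a})) ((λ (a , _) → ≤-trans z<s (toℕ<n a)) , some-element)
    where
    some-element : 1 ≤ n → Σ (Fin n) λ a → toℕ a ≡ toℕ a
    some-element (s≤s _) = zero , refl

  increasing-spec :
    Iff (ev (∀f (∀f (rename (args₂ x₁ x₀) (composeFormula F) ⇔f (x₁ <V x₀)))) []v ≡ true) Increasing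
  increasing-spec = all-iff λ a → all-iff λ b →
    ⇔-iff (iff-≡true (evalWith-args₂ x₁ x₀ (composeFormula F) (b ∷v a ∷v []v)) iff-refl) <ᵇ-iff

  preimage-spec : Iff (eval σ (preimageFormula F) []v ≡ true) (preimageI F n σ)
  preimage-spec = iff-≡true (eval≡evalWith σ (preimageFormula F) []v)
    (∧-iff nonempty-spec (iff-trans increasing-spec (Increasing⇒≡upTo , ≡upTo⇒Increasing)))

preimage-definable : ∀ F → Definable (preimageI F)
preimage-definable F = preimageFormula F , λ n σ → iff⇒⇔ (Preimage.preimage-spec F σ)

proposition3p16 : (OpDefinable stackSort × OpDefinable bubbleSort × OpDefinable queueSort)
    × ((F : List Op) → Definable (preimageI F))
proposition3p16 = (opDefinable S , opDefinable B , opDefinable Q) , preimage-definable
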